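{- Let $\mathbb{F}$ be a field. The p-family $\mathrm{PAL}=(\mathrm{PAL}_n)$, $\mathrm{PAL}_n=\sum_{w\in\{x_0,x_1\}^n} w\,w^R$, is $\mathrm{VSK}_{nc}$-complete under $\leq_{abp}$-reductions; that is, $\mathrm{PAL}\in\mathrm{VSK}_{nc}$ and every p-family $f\in \mathrm{VSK}_{nc}$ satisfies $f\leq_{abp}\mathrm{PAL}$.
   Context: Noncommutative polynomials live in $\mathbb{F}\langle X\rangle$ (linear combinations of words over noncommuting variables $X$); $w^R$ denotes the reversal of the word $w$. A noncommutative arithmetic circuit is a DAG with inputs labelled by variables or field elements and fan-in-2 $+$ and $\times$ gates, the latter having ordered (left, right) children. A skew circuit is such a circuit in which every $\times$ gate has at least one child that is an input (a variable or a field constant). A p-family is a sequence $f=(f_n)$ of noncommutative polynomials whose number of variables and degree are bounded by $n^c$ for a constant $c$. $\mathrm{VSK}_{nc}$ is the class of p-families $f=(f_n)$ such that $f_n$ has a noncommutative skew circuit of size polynomial in $n$. For p-families $f=(f_n)$, $f_n\in\mathbb{F}\langle X_n\rangle$, and $g=(g_n)$, $g_n\in\mathbb{F}\langle Y_n\rangle$, $f\leq_{abp} g$ means there are polynomials $p(n),q(n)$ and maps $\phi$ sending each variable of $Y_{p(n)}$ to a $q(n)\times q(n)$ matrix with entries field elements or variables of $X_n$ (the paper also allows constant-degree monomials over $X_n$), such that $f_n$ is the $(1,q(n))$ entry of $g_{p(n)}(\phi(Y_{p(n)}))$. -}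

module Defs where

open import Level using (Level; _⊔_; suc)
open import Algebra.Bundles using (CommutativeRing)
open import Data.Nat as ℕ using (ℕ; _≤_; _^_; _<_)
open import Data.Fin as Fin using (Fin; zero; fromℕ)
open import Data.Fin.Properties using () renaming (_≟_ to _≟ᶠ_)
open import Data.List using (List; []; _∷_; _++_; map; concatMap; reverse; foldr; length)
open import Data.List.Properties using (≡-dec)
open import Data.Product using (Σ; ∃; ∃-syntax; _×_; _,_)
open import Data.Sum using (_⊎_)
open import Relation.Nullary using (¬_; yes; no)
open import Relation.Binary.PropositionalEquality using (_≡_)

record Field (c ℓ : Level) : Set (Level.suc (c ⊔ ℓ)) where
  field
    commRing : CommutativeRing c ℓ
  open CommutativeRing commRing public
  field
    0≉1      : ¬ (0# ≈ 1#)
    inverse  : ∀ x → ¬ (x ≈ 0#) → ∃[ y ] (x * y ≈ 1#)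

-- Natural-number polynomials (used for the maps p(n), q(n) of reductions):
-- coefficient list a₀ ∷ a₁ ∷ … denotes a₀ + a₁ n + a₂ n² + …

evalℕPoly : List ℕ → ℕ → ℕ
evalℕPoly []       n = 0
evalℕPoly (a ∷ as) n = a ℕ.+ n ℕ.* evalℕPoly as n

-- "bounded by n^c" (additive constant c so that small n are harmless)
PolyBounded : (ℕ → ℕ) → Set
PolyBounded b = ∃[ c ] (∀ n → b n ≤ n ^ c ℕ.+ c)

module Over {c ℓ : Level} (F : Field c ℓ) where
  open Field F using (Carrier; _≈_; _+_; _*_; 0#; 1#)

  Word : ℕ → Set
  Word k = List (Fin k)

  -- A noncommutative polynomial in F⟨x₀,…,x_{k-1}⟩ given as a finite formal
  -- sum of terms (coefficient, monomial).  Equality is semantic (below).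
  NCPoly : ℕ → Set c
  NCPoly k = List (Carrier × Word k)

  coeff : ∀ {k} → NCPoly k → Word k → Carrier
  coeff []            w = 0#
  coeff ((a , u) ∷ p) w with ≡-dec _≟ᶠ_ u w
  ... | yes _ = a + coeff p w
  ... | no  _ = coeff p w

  _≋_ : ∀ {k} → NCPoly k → NCPoly k → Set ℓ
  p ≋ q = ∀ w → coeff p w ≈ coeff q w

  0ᴾ : ∀ {k} → NCPoly k
  0ᴾ = []

  1ᴾ : ∀ {k} → NCPoly k
  1ᴾ = (1# , []) ∷ []

  constᴾ : ∀ {k} → Carrier → NCPoly k
  constᴾ a = (a , []) ∷ []

  varᴾ : ∀ {k} → Fin k → NCPoly k
  varᴾ x = (1# , x ∷ []) ∷ []

  _+ᴾ_ : ∀ {k} → NCPoly k → NCPoly k → NCPoly k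
  p +ᴾ q = p ++ q

  _*ᴾ_ : ∀ {k} → NCPoly k → NCPoly k → NCPoly k
  p *ᴾ q = concatMap (λ { (a , u) → map (λ { (b , v) → (a * b , u ++ v) }) q }) p

  scaleᴾ : ∀ {k} → Carrier → NCPoly k → NCPoly k
  scaleᴾ a p = constᴾ a *ᴾ p

  DegreeAtMost : ∀ {k} → ℕ → NCPoly k → Set ℓ
  DegreeAtMost d p = ∀ w → d < length w → coeff p w ≈ 0#

  record Family : Set c where
    field
      nvars : ℕ → ℕ
      poly  : (n : ℕ) → NCPoly (nvars n)
  open Family public

  IsPFamily : Family → Set ℓ
  IsPFamily f = ∃[ e ] (∀ n → nvars f n ≤ n ^ e ℕ.+ e
                              × DegreeAtMost (n ^ e ℕ.+ e) (poly f n))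

  -- Noncommutative skew circuits, as straight-line programs.  Gate number i may only
  -- refer to gates 0,…,i-1 (so the circuit is a DAG).  A × gate has
  -- ordered children and (skewness) at least one child is an input:
  -- mulL a j computes a · g_j, mulR j a computes g_j · a.

  data Input (k : ℕ) : Set c where
    var : Fin k → Input k
    cst : Carrier → Input k

  data Gate (k : ℕ) (i : ℕ) : Set c where
    inp  : Input k → Gate k i
    add  : Fin i → Fin i → Gate k i
    mulL : Input k → Fin i → Gate k i
    mulR : Fin i → Input k → Gate k i

  data Gates (k : ℕ) : ℕ → Set c where
    []  : Gates k 0
    _▷_ : ∀ {i} → Gates k i → Gate k i → Gates k (ℕ.suc i)

  evalInput : ∀ {k} → Input k → NCPoly k
  evalInput (var x) = varᴾ x
  evalInput (cst a) = constᴾ a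

  evalGates : ∀ {k i} → Gates k i → Fin i → NCPoly k
  evalGates (gs ▷ g) zero     = evalGate g
    where
    prev = evalGates gs
    evalGate : _ → _
    evalGate (inp a)    = evalInput a
    evalGate (add j l)  = prev j +ᴾ prev l
    evalGate (mulL a j) = evalInput a *ᴾ prev j
    evalGate (mulR j a) = prev j *ᴾ evalInput a
  evalGates (gs ▷ g) (Fin.suc j) = evalGates gs j

  -- Note: in evalGates the index zero denotes the LAST gate (most recent);
  -- the output of a nonempty circuit is gate zero in this numbering, and
  -- Fin i in a gate refers to earlier gates with 0 = most recent.

  SkewCircuitOfSize : ∀ {k} → ℕ → NCPoly k → Set (c ⊔ ℓ)
  SkewCircuitOfSize {k} s f =
    Σ ℕ λ s′ → (ℕ.suc s′ ≤ s) × Σ (Gates k (ℕ.suc s′)) λ gs → evalGates gs zero ≋ f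

  VSKnc : Family → Set (c ⊔ ℓ)
  VSKnc f = IsPFamily f ×
            ∃[ e ] (∀ n → SkewCircuitOfSize (n ^ e ℕ.+ e) (poly f n))

  Matrix : ℕ → ℕ → Set c
  Matrix k m = Fin m → Fin m → NCPoly k

  sumFin : ∀ {k} m → (Fin m → NCPoly k) → NCPoly k
  sumFin ℕ.zero    h = 0ᴾ
  sumFin (ℕ.suc m) h = h zero +ᴾ sumFin m (λ j → h (Fin.suc j))

  idM : ∀ {k m} → Matrix k m
  idM i j with i ≟ᶠ j
  ... | yes _ = 1ᴾ
  ... | no  _ = 0ᴾ

  _*M_ : ∀ {k m} → Matrix k m → Matrix k m → Matrix k m
  _*M_ {m = m} A B i j = sumFin m (λ l → A i l *ᴾ B l j)

  _+M_ : ∀ {k m} → Matrix k m → Matrix k m → Matrix k m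
  (A +M B) i j = A i j +ᴾ B i j

  scaleM : ∀ {k m} → Carrier → Matrix k m → Matrix k m
  scaleM a A i j = scaleᴾ a (A i j)

  zeroM : ∀ {k m} → Matrix k m
  zeroM i j = 0ᴾ

  evalAtMatrices : ∀ {r k m} → NCPoly r → (Fin r → Matrix k m) → Matrix k m
  evalAtMatrices []            φ = zeroM
  evalAtMatrices ((a , w) ∷ g) φ =
    scaleM a (foldr (λ y M → φ y *M M) idM w) +M evalAtMatrices g φ

  data Entry (k : ℕ) : Set c where
    fe : Carrier → Entry k
    xv : Fin k → Entry k

  evalEntry : ∀ {k} → Entry k → NCPoly k
  evalEntry (fe a) = constᴾ a
  evalEntry (xv x) = varᴾ x

  -- f ≤_abp g.  Matrices have dimension q(n) = suc (q′ n) ≥ 1; the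
  -- (1,q(n)) entry is (zero, fromℕ (q′ n)).
  _≤abp_ : Family → Family → Set (c ⊔ ℓ)
  f ≤abp g =
    ∃[ ps ] ∃[ qs ]
      (let p  = evalℕPoly ps
           q′ = evalℕPoly qs in
       ∀ n → Σ (Fin (nvars g (p n)) → Fin (ℕ.suc (q′ n)) → Fin (ℕ.suc (q′ n)) → Entry (nvars f n)) λ φ →
         poly f n ≋ evalAtMatrices (poly g (p n)) (λ y i j → evalEntry (φ y i j)) zero (fromℕ (q′ n)))

  allWords : ∀ {k} → ℕ → List (Word k)
  allWords ℕ.zero    = [] ∷ []
  allWords {k} (ℕ.suc n) =
    concatMap (λ w → map (λ x → x ∷ w) (allFinL k)) (allWords n)
    where
    allFinL : ∀ k → List (Fin k)
    allFinL ℕ.zero    = []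
    allFinL (ℕ.suc k) = zero ∷ map Fin.suc (allFinL k)

  PAL : Family
  PAL = record
    { nvars = λ _ → 2
    ; poly  = λ n → map (λ w → (1# , w ++ reverse w)) (allWords n)
    }

-- PAL_{n+1} = x₀ PAL_n x₀ + x₁ PAL_n x₁, so PAL_n has a skew circuit with five gates per level.
-- The same recursion PAL_{m+1}(A) = A₀ PAL_m(A) A₀ + A₁ PAL_m(A) A₁ holds for matrices A₀, A₁.
-- For a skew circuit with gates g₀ (the output), …, g_{s-1}, each reading only gates of larger index,
-- index the matrices by nodes top j, bot j (one pair per gate) and mid. Every gate is a sum of two
-- terms λ · h · ρ with h a gate of larger index or the constant 1 and λ, ρ inputs: a g_c = a g_c 1 + 0,
-- g_c a = 1 g_c a + 0, g_c + g_l = 1 g_c 1 + 1 g_l 1 and a = 0 + a 1 1. The row of top j and the column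
-- of bot j in A_b hold λ and ρ of the b-th term, pointing to top and bot of h, or to mid for h = 1;
-- a loop A₀[mid, mid] = 1 keeps the (mid, mid) entry of PAL_m(A) equal to 1. As no entry leads from a
-- node other than a top node to a top node, induction on m shows that the (top j, bot j) entry of
-- PAL_m(A) is g_j as soon as m + j ≥ s; the output is the entry (top 0, bot 0) = (0, Q).

module Submission where

open import Level using (Level)
open import Algebra.Bundles using (Semiring)
open import Data.Fin as Fin using (Fin; zero; suc; toℕ; fromℕ; fromℕ<; punchIn)
open import Data.Fin.Properties using (punchInᵢ≢i; toℕ-fromℕ<; toℕ<n; toℕ-injective; toℕ-fromℕ)
  renaming (_≟_ to _≟ᶠ_)
open import Data.List using (List; []; _∷_; _++_; map; concatMap; reverse; foldr; length; drop; take)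
open import Data.List.Properties using (≡-dec; ++-assoc; ++-identityʳ; length-++; length-reverse; unfold-reverse)
open import Data.List.Relation.Unary.All as All using (All; []; _∷_)
open import Data.List.Relation.Unary.All.Properties using (concat⁺; gmap⁺)
open import Data.Maybe using (Maybe; just; nothing)
open import Data.Maybe.Properties using (just-injective)
open import Data.Nat as ℕ using (ℕ; _∸_; _≤_; _<_; z≤n; s≤s)
open import Data.Nat.Properties
  using ( ≤-trans; ≤-reflexive; <⇒≤; <⇒≱; ≤⇒≯; <⇒≢; <-≤-trans; n≤1+n; m≤m+n; m≤n+m; m∸n≤m
        ; m+n∸n≡m; m∸[m∸n]≡n; m+n≤o⇒m≤o∸n; +-suc; +-monoʳ-≤; +-monoʳ-<; *-monoʳ-≤; ^-monoˡ-≤ )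
open import Data.Product using (Σ; ∃; _×_; _,_; proj₁; proj₂)
open import Data.Unit using (⊤; tt)
open import Function using (_∘_)
open import Relation.Binary.PropositionalEquality as ≡ using (_≡_; _≢_)
open import Relation.Binary.Structures using (IsEquivalence)
open import Relation.Nullary using (¬_; yes; no; contradiction)
open import Relation.Unary using (Pred; Decidable)
open import Defs

module FiniteSums {c ℓ} (R : Semiring c ℓ) where
  open Semiring R
  open import Algebra.Properties.Semiring.Sum R public
  open import Algebra.Properties.CommutativeSemigroup +-commutativeSemigroup using (interchange)
  open import Relation.Binary.Reasoning.Setoid setoid

  sum-zero : ∀ n (h : Fin n → Carrier) → (∀ i → h i ≈ 0#) → sum h ≈ 0#
  sum-zero n h h≈0 = trans (sum-cong-≋ h≈0) (sum-replicate-zero n)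

  sum-single : ∀ {n} (h : Fin n → Carrier) (i : Fin n) → (∀ j → j ≢ i → h j ≈ 0#) → sum h ≈ h i
  sum-single {ℕ.suc n} h i h≈0 = begin
    sum h                      ≈⟨ sum-remove h ⟩
    h i + sum (h ∘ punchIn i)  ≈⟨ +-congˡ (sum-zero n _ (λ j → h≈0 (punchIn i j) (punchInᵢ≢i i j))) ⟩
    h i + 0#                   ≈⟨ +-identityʳ (h i) ⟩
    h i                        ∎

  private
    variable
      a b : Level
      A B : Set a

  ∑ˡ : List A → (A → Carrier) → Carrier
  ∑ˡ []       f = 0#
  ∑ˡ (x ∷ xs) f = f x + ∑ˡ xs f

  infix 5 ∑ˡ
  syntax ∑ˡ xs (λ x → e) = ∑[ x ∈ xs ] e

  ∑ˡ-cong : ∀ (xs : List A) {f g : A → Carrier} → (∀ x → f x ≈ g x) → ∑ˡ xs f ≈ ∑ˡ xs g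
  ∑ˡ-cong []       f≈g = refl
  ∑ˡ-cong (x ∷ xs) f≈g = +-cong (f≈g x) (∑ˡ-cong xs f≈g)

  ∑ˡ-zero : ∀ (xs : List A) (f : A → Carrier) → (∀ x → f x ≈ 0#) → ∑ˡ xs f ≈ 0#
  ∑ˡ-zero []       f f≈0 = refl
  ∑ˡ-zero (x ∷ xs) f f≈0 = trans (+-cong (f≈0 x) (∑ˡ-zero xs f f≈0)) (+-identityˡ 0#)

  ∑ˡ-++ : ∀ (xs ys : List A) (f : A → Carrier) → ∑ˡ (xs ++ ys) f ≈ ∑ˡ xs f + ∑ˡ ys f
  ∑ˡ-++ []       ys f = sym (+-identityˡ _)
  ∑ˡ-++ (x ∷ xs) ys f = trans (+-congˡ (∑ˡ-++ xs ys f)) (sym (+-assoc _ _ _))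

  ∑ˡ-distrib-+ : ∀ (xs : List A) (f g : A → Carrier) →
                 ∑[ x ∈ xs ] (f x + g x) ≈ ∑ˡ xs f + ∑ˡ xs g
  ∑ˡ-distrib-+ []       f g = sym (+-identityˡ 0#)
  ∑ˡ-distrib-+ (x ∷ xs) f g = trans (+-congˡ (∑ˡ-distrib-+ xs f g)) (interchange _ _ _ _)

  *-distribˡ-∑ˡ : ∀ (xs : List A) y (f : A → Carrier) → y * ∑ˡ xs f ≈ ∑[ x ∈ xs ] (y * f x)
  *-distribˡ-∑ˡ []       y f = zeroʳ y
  *-distribˡ-∑ˡ (x ∷ xs) y f = trans (distribˡ y _ _) (+-congˡ (*-distribˡ-∑ˡ xs y f))

  *-distribʳ-∑ˡ : ∀ (xs : List A) y (f : A → Carrier) → ∑ˡ xs f * y ≈ ∑[ x ∈ xs ] (f x * y)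
  *-distribʳ-∑ˡ []       y f = zeroˡ y
  *-distribʳ-∑ˡ (x ∷ xs) y f = trans (distribʳ y _ _) (+-congˡ (*-distribʳ-∑ˡ xs y f))

  ∑ˡ-comm : (xs : List A) (ys : List B) (f : A → B → Carrier) →
            ∑[ x ∈ xs ] ∑[ y ∈ ys ] f x y ≈ ∑[ y ∈ ys ] ∑[ x ∈ xs ] f x y
  ∑ˡ-comm []       ys f = sym (∑ˡ-zero ys _ (λ _ → refl))
  ∑ˡ-comm (x ∷ xs) ys f = trans (+-congˡ (∑ˡ-comm xs ys f)) (sym (∑ˡ-distrib-+ ys (f x) _))

  ∑ˡ-map : (g : A → B) (xs : List A) (f : B → Carrier) →
           ∑ˡ (map g xs) f ≈ ∑[ x ∈ xs ] f (g x)
  ∑ˡ-map g []       f = refl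
  ∑ˡ-map g (x ∷ xs) f = +-congˡ (∑ˡ-map g xs f)

  ∑ˡ-concatMap : (g : A → List B) (xs : List A) (f : B → Carrier) →
                 ∑ˡ (concatMap g xs) f ≈ ∑[ x ∈ xs ] ∑ˡ (g x) f
  ∑ˡ-concatMap g []       f = refl
  ∑ˡ-concatMap g (x ∷ xs) f = trans (∑ˡ-++ (g x) _ f) (+-congˡ (∑ˡ-concatMap g xs f))

module _ {a} {A : Set a} where

  afterPrefix beforeSuffix : List A → List A → List A
  afterPrefix  u w = drop (length u) w
  beforeSuffix v w = take (length w ∸ length v) w

  drop-length-++ : ∀ (u v : List A) → drop (length u) (u ++ v) ≡ v
  drop-length-++ []      v = ≡.refl
  drop-length-++ (x ∷ u) v = drop-length-++ u v

  take-length-++ : ∀ (u v : List A) → take (length u) (u ++ v) ≡ u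
  take-length-++ []      v = ≡.refl
  take-length-++ (x ∷ u) v = ≡.cong (x ∷_) (take-length-++ u v)

  ++-afterPrefix : ∀ {u v w : List A} → u ++ v ≡ w → v ≡ afterPrefix u w
  ++-afterPrefix {u} {v} ≡.refl = ≡.sym (drop-length-++ u v)

  ++-beforeSuffix : ∀ {u v w : List A} → u ++ v ≡ w → u ≡ beforeSuffix v w
  ++-beforeSuffix {u} {v} ≡.refl = ≡.sym (≡.trans
    (≡.cong (λ n → take n (u ++ v)) (≡.trans (≡.cong (_∸ length v) (length-++ u)) (m+n∸n≡m (length u) (length v))))
    (take-length-++ u v))

module Polynomials {c ℓ} (F : Field c ℓ) where
  open Field F
  open Over F
  open FiniteSums semiring
  open import Relation.Binary.Reasoning.Setoid setoid

  δ : ∀ {k} → Word k → Word k → Carrier → Carrier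
  δ u w a with ≡-dec _≟ᶠ_ u w
  ... | yes _ = a
  ... | no  _ = 0#

  module _ {k} (u w : Word k) where

    δ-cong : ∀ {a b} → a ≈ b → δ u w a ≈ δ u w b
    δ-cong a≈b with ≡-dec _≟ᶠ_ u w
    ... | yes _ = a≈b
    ... | no  _ = refl

    δ-zero : δ u w 0# ≈ 0#
    δ-zero with ≡-dec _≟ᶠ_ u w
    ... | yes _ = refl
    ... | no  _ = refl

    δ-+ : ∀ a b → δ u w (a + b) ≈ δ u w a + δ u w b
    δ-+ a b with ≡-dec _≟ᶠ_ u w
    ... | yes _ = refl
    ... | no  _ = sym (+-identityˡ 0#)

    δ-*ˡ : ∀ a b → δ u w (a * b) ≈ a * δ u w b
    δ-*ˡ a b with ≡-dec _≟ᶠ_ u w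
    ... | yes _ = refl
    ... | no  _ = sym (zeroʳ a)

    δ-*ʳ : ∀ a b → δ u w (a * b) ≈ δ u w a * b
    δ-*ʳ a b with ≡-dec _≟ᶠ_ u w
    ... | yes _ = refl
    ... | no  _ = sym (zeroˡ b)

    δ-∑ˡ : ∀ {a} {A : Set a} (xs : List A) (f : A → Carrier) → ∑[ x ∈ xs ] δ u w (f x) ≈ δ u w (∑ˡ xs f)
    δ-∑ˡ []       f = sym δ-zero
    δ-∑ˡ (x ∷ xs) f = trans (+-congˡ (δ-∑ˡ xs f)) (sym (δ-+ _ _))

  coeff-∑ : ∀ {k} (p : NCPoly k) w → coeff p w ≈ ∑[ t ∈ p ] δ (proj₂ t) w (proj₁ t)
  coeff-∑ []            w = refl
  coeff-∑ ((a , u) ∷ p) w with ≡-dec _≟ᶠ_ u w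
  ... | yes _ = +-congˡ (coeff-∑ p w)
  ... | no  _ = trans (coeff-∑ p w) (sym (+-identityˡ _))

  ∑-δ-preimage : ∀ {k} (g : Word k → Word k) (w v₀ : Word k) → (∀ v → g v ≡ w → v ≡ v₀) → ∀ q →
                 ∑[ t ∈ q ] δ (g (proj₂ t)) w (proj₁ t) ≈ δ (g v₀) w (coeff q v₀)
  ∑-δ-preimage g w v₀ unique q = begin
    ∑[ t ∈ q ] δ (g (proj₂ t)) w (proj₁ t)          ≈⟨ ∑ˡ-cong q (λ t → through (proj₂ t) (proj₁ t)) ⟩
    ∑[ t ∈ q ] δ (g v₀) w (δ (proj₂ t) v₀ (proj₁ t)) ≈⟨ δ-∑ˡ (g v₀) w q _ ⟩
    δ (g v₀) w (∑[ t ∈ q ] δ (proj₂ t) v₀ (proj₁ t)) ≈⟨ δ-cong (g v₀) w (coeff-∑ q v₀) ⟨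
    δ (g v₀) w (coeff q v₀)                          ∎
    where
    through : ∀ v b → δ (g v) w b ≈ δ (g v₀) w (δ v v₀ b)
    through v b with ≡-dec _≟ᶠ_ v v₀
    ... | yes ≡.refl = refl
    ... | no v≢v₀ with ≡-dec _≟ᶠ_ (g v) w
    ...   | yes gv≡w = contradiction (unique v gv≡w) v≢v₀
    ...   | no  _    = sym (δ-zero (g v₀) w)

  infix 4 _≃_

  -- Unlike _≋_, a record lets Agda recover both polynomials from an equality proof.
  record _≃_ {k} (p q : NCPoly k) : Set ℓ where
    constructor coeffwise
    field coeff-≈ : p ≋ q
  open _≃_ public

  module _ {k : ℕ} where

    ≃-isEquivalence : IsEquivalence (_≃_ {k})
    ≃-isEquivalence = record
      { refl  = coeffwise (λ _ → refl)
      ; sym   = λ p≃q → coeffwise (λ w → sym (coeff-≈ p≃q w))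
      ; trans = λ p≃q q≃r → coeffwise (λ w → trans (coeff-≈ p≃q w) (coeff-≈ q≃r w))
      }

    ≃-reflexive : ∀ {p q : NCPoly k} → p ≡ q → p ≃ q
    ≃-reflexive ≡.refl = IsEquivalence.refl ≃-isEquivalence

    coeff-++ : ∀ (p q : NCPoly k) w → coeff (p ++ q) w ≈ coeff p w + coeff q w
    coeff-++ p q w = begin
      coeff (p ++ q) w                           ≈⟨ coeff-∑ (p ++ q) w ⟩
      ∑[ t ∈ p ++ q ] δ (proj₂ t) w (proj₁ t)     ≈⟨ ∑ˡ-++ p q _ ⟩
      (∑[ t ∈ p ] δ (proj₂ t) w (proj₁ t)) + (∑[ t ∈ q ] δ (proj₂ t) w (proj₁ t))
                                                  ≈⟨ +-cong (coeff-∑ p w) (coeff-∑ q w) ⟨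
      coeff p w + coeff q w                       ∎

    ∑ˡ-*ᴾ : ∀ (p q : NCPoly k) (f : Carrier × Word k → Carrier) →
            ∑ˡ (p *ᴾ q) f ≈ ∑[ t ∈ p ] ∑[ s ∈ q ] f (proj₁ t * proj₁ s , proj₂ t ++ proj₂ s)
    ∑ˡ-*ᴾ p q f = trans (∑ˡ-concatMap _ p f) (∑ˡ-cong p (λ t → ∑ˡ-map _ q f))

    coeff-*ᴾ : ∀ (p q : NCPoly k) w →
               coeff (p *ᴾ q) w ≈ ∑[ t ∈ p ] ∑[ s ∈ q ] δ (proj₂ t ++ proj₂ s) w (proj₁ t * proj₁ s)
    coeff-*ᴾ p q w = trans (coeff-∑ (p *ᴾ q) w) (∑ˡ-*ᴾ p q _)

    coeff-*ᴾ-viaRight : ∀ (p q : NCPoly k) w → coeff (p *ᴾ q) w ≈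
      ∑[ t ∈ p ] proj₁ t * δ (proj₂ t ++ afterPrefix (proj₂ t) w) w (coeff q (afterPrefix (proj₂ t) w))
    coeff-*ᴾ-viaRight p q w = trans (coeff-*ᴾ p q w) (∑ˡ-cong p λ (a , u) → begin
      ∑[ s ∈ q ] δ (u ++ proj₂ s) w (a * proj₁ s)
        ≈⟨ ∑ˡ-cong q (λ s → δ-*ˡ (u ++ proj₂ s) w a (proj₁ s)) ⟩
      ∑[ s ∈ q ] a * δ (u ++ proj₂ s) w (proj₁ s)
        ≈⟨ *-distribˡ-∑ˡ q a _ ⟨
      a * (∑[ s ∈ q ] δ (u ++ proj₂ s) w (proj₁ s))
        ≈⟨ *-congˡ (∑-δ-preimage (u ++_) w _ (λ v → ++-afterPrefix) q) ⟩
      a * δ (u ++ afterPrefix u w) w (coeff q (afterPrefix u w)) ∎)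

    coeff-*ᴾ-viaLeft : ∀ (p q : NCPoly k) w → coeff (p *ᴾ q) w ≈
      ∑[ s ∈ q ] δ (beforeSuffix (proj₂ s) w ++ proj₂ s) w (coeff p (beforeSuffix (proj₂ s) w)) * proj₁ s
    coeff-*ᴾ-viaLeft p q w = trans (coeff-*ᴾ p q w) (trans (∑ˡ-comm p q _) (∑ˡ-cong q λ (b , v) → begin
      ∑[ t ∈ p ] δ (proj₂ t ++ v) w (proj₁ t * b)
        ≈⟨ ∑ˡ-cong p (λ t → δ-*ʳ (proj₂ t ++ v) w (proj₁ t) b) ⟩
      ∑[ t ∈ p ] δ (proj₂ t ++ v) w (proj₁ t) * b
        ≈⟨ *-distribʳ-∑ˡ p b _ ⟨
      (∑[ t ∈ p ] δ (proj₂ t ++ v) w (proj₁ t)) * b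
        ≈⟨ *-congʳ (∑-δ-preimage (_++ v) w _ (λ u → ++-beforeSuffix) p) ⟩
      δ (beforeSuffix v w ++ v) w (coeff p (beforeSuffix v w)) * b ∎))

    +ᴾ-cong : ∀ {p p′ q q′ : NCPoly k} → p ≃ p′ → q ≃ q′ → p +ᴾ q ≃ p′ +ᴾ q′
    +ᴾ-cong {p} {p′} {q} {q′} p≃p′ q≃q′ = coeffwise λ w → begin
      coeff (p ++ q) w        ≈⟨ coeff-++ p q w ⟩
      coeff p w + coeff q w   ≈⟨ +-cong (coeff-≈ p≃p′ w) (coeff-≈ q≃q′ w) ⟩
      coeff p′ w + coeff q′ w ≈⟨ coeff-++ p′ q′ w ⟨
      coeff (p′ ++ q′) w      ∎

    +ᴾ-assoc : ∀ (p q r : NCPoly k) → (p +ᴾ q) +ᴾ r ≃ p +ᴾ (q +ᴾ r)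
    +ᴾ-assoc p q r = ≃-reflexive (++-assoc p q r)

    +ᴾ-comm : ∀ (p q : NCPoly k) → p +ᴾ q ≃ q +ᴾ p
    +ᴾ-comm p q = coeffwise λ w → trans (coeff-++ p q w) (trans (+-comm _ _) (sym (coeff-++ q p w)))

    +ᴾ-identityʳ : ∀ (p : NCPoly k) → p +ᴾ 0ᴾ ≃ p
    +ᴾ-identityʳ p = ≃-reflexive (++-identityʳ p)

    *ᴾ-congʳ : ∀ (p : NCPoly k) {q q′} → q ≃ q′ → p *ᴾ q ≃ p *ᴾ q′
    *ᴾ-congʳ p {q} {q′} q≃q′ = coeffwise λ w → begin
      coeff (p *ᴾ q) w
        ≈⟨ coeff-*ᴾ-viaRight p q w ⟩
      ∑[ t ∈ p ] proj₁ t * δ (proj₂ t ++ afterPrefix (proj₂ t) w) w (coeff q (afterPrefix (proj₂ t) w))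
        ≈⟨ ∑ˡ-cong p (λ t → *-congˡ (δ-cong (proj₂ t ++ afterPrefix (proj₂ t) w) w (coeff-≈ q≃q′ _))) ⟩
      ∑[ t ∈ p ] proj₁ t * δ (proj₂ t ++ afterPrefix (proj₂ t) w) w (coeff q′ (afterPrefix (proj₂ t) w))
        ≈⟨ coeff-*ᴾ-viaRight p q′ w ⟨
      coeff (p *ᴾ q′) w ∎

    *ᴾ-congˡ : ∀ {p p′ : NCPoly k} (q : NCPoly k) → p ≃ p′ → p *ᴾ q ≃ p′ *ᴾ q
    *ᴾ-congˡ {p} {p′} q p≃p′ = coeffwise λ w → begin
      coeff (p *ᴾ q) w
        ≈⟨ coeff-*ᴾ-viaLeft p q w ⟩
      ∑[ s ∈ q ] δ (beforeSuffix (proj₂ s) w ++ proj₂ s) w (coeff p (beforeSuffix (proj₂ s) w)) * proj₁ s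
        ≈⟨ ∑ˡ-cong q (λ s → *-congʳ (δ-cong (beforeSuffix (proj₂ s) w ++ proj₂ s) w (coeff-≈ p≃p′ _))) ⟩
      ∑[ s ∈ q ] δ (beforeSuffix (proj₂ s) w ++ proj₂ s) w (coeff p′ (beforeSuffix (proj₂ s) w)) * proj₁ s
        ≈⟨ coeff-*ᴾ-viaLeft p′ q w ⟨
      coeff (p′ *ᴾ q) w ∎

    *ᴾ-cong : ∀ {p p′ q q′ : NCPoly k} → p ≃ p′ → q ≃ q′ → p *ᴾ q ≃ p′ *ᴾ q′
    *ᴾ-cong {p} {p′} {q} p≃p′ q≃q′ = coeffwise λ w →
      trans (coeff-≈ (*ᴾ-congˡ q p≃p′) w) (coeff-≈ (*ᴾ-congʳ p′ q≃q′) w)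

    *ᴾ-assoc : ∀ (p q r : NCPoly k) → (p *ᴾ q) *ᴾ r ≃ p *ᴾ (q *ᴾ r)
    *ᴾ-assoc p q r = coeffwise λ w → begin
      coeff ((p *ᴾ q) *ᴾ r) w
        ≈⟨ trans (coeff-*ᴾ (p *ᴾ q) r w) (∑ˡ-*ᴾ p q _) ⟩
      ∑[ x ∈ p ] ∑[ y ∈ q ] ∑[ z ∈ r ] δ ((proj₂ x ++ proj₂ y) ++ proj₂ z) w ((proj₁ x * proj₁ y) * proj₁ z)
        ≈⟨ ∑ˡ-cong p (λ x → ∑ˡ-cong q (λ y → ∑ˡ-cong r (λ z → trans
             (reflexive (≡.cong (λ u → δ u w ((proj₁ x * proj₁ y) * proj₁ z))
                                (++-assoc (proj₂ x) (proj₂ y) (proj₂ z))))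
             (δ-cong (proj₂ x ++ (proj₂ y ++ proj₂ z)) w (*-assoc (proj₁ x) (proj₁ y) (proj₁ z)))))) ⟩
      ∑[ x ∈ p ] ∑[ y ∈ q ] ∑[ z ∈ r ] δ (proj₂ x ++ (proj₂ y ++ proj₂ z)) w (proj₁ x * (proj₁ y * proj₁ z))
        ≈⟨ trans (coeff-*ᴾ p (q *ᴾ r) w) (∑ˡ-cong p (λ x → ∑ˡ-*ᴾ q r _)) ⟨
      coeff (p *ᴾ (q *ᴾ r)) w ∎

    *ᴾ-distribˡ : ∀ (p q r : NCPoly k) → p *ᴾ (q +ᴾ r) ≃ (p *ᴾ q) +ᴾ (p *ᴾ r)
    *ᴾ-distribˡ p q r = coeffwise λ w → begin
      coeff (p *ᴾ (q ++ r)) w                     ≈⟨ coeff-*ᴾ p (q ++ r) w ⟩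
      _                                           ≈⟨ ∑ˡ-cong p (λ t → ∑ˡ-++ q r _) ⟩
      _                                           ≈⟨ ∑ˡ-distrib-+ p _ _ ⟩
      _                                           ≈⟨ +-cong (coeff-*ᴾ p q w) (coeff-*ᴾ p r w) ⟨
      coeff (p *ᴾ q) w + coeff (p *ᴾ r) w          ≈⟨ coeff-++ (p *ᴾ q) (p *ᴾ r) w ⟨
      coeff (p *ᴾ q ++ p *ᴾ r) w                   ∎

    *ᴾ-distribʳ : ∀ (r p q : NCPoly k) → (p +ᴾ q) *ᴾ r ≃ (p *ᴾ r) +ᴾ (q *ᴾ r)
    *ᴾ-distribʳ r p q = coeffwise λ w → begin
      coeff ((p ++ q) *ᴾ r) w                     ≈⟨ coeff-*ᴾ (p ++ q) r w ⟩
      _                                           ≈⟨ ∑ˡ-++ p q _ ⟩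
      _                                           ≈⟨ +-cong (coeff-*ᴾ p r w) (coeff-*ᴾ q r w) ⟨
      coeff (p *ᴾ r) w + coeff (q *ᴾ r) w          ≈⟨ coeff-++ (p *ᴾ r) (q *ᴾ r) w ⟨
      coeff (p *ᴾ r ++ q *ᴾ r) w                   ∎

    *ᴾ-identityˡ : ∀ (p : NCPoly k) → 1ᴾ *ᴾ p ≃ p
    *ᴾ-identityˡ p = coeffwise λ w → begin
      coeff (1ᴾ *ᴾ p) w                              ≈⟨ trans (coeff-*ᴾ 1ᴾ p w) (+-identityʳ _) ⟩
      ∑[ s ∈ p ] δ (proj₂ s) w (1# * proj₁ s)        ≈⟨ ∑ˡ-cong p (λ s → δ-cong (proj₂ s) w (*-identityˡ _)) ⟩
      ∑[ s ∈ p ] δ (proj₂ s) w (proj₁ s)             ≈⟨ coeff-∑ p w ⟨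
      coeff p w                                      ∎

    *ᴾ-identityʳ : ∀ (p : NCPoly k) → p *ᴾ 1ᴾ ≃ p
    *ᴾ-identityʳ p = coeffwise λ w → begin
      coeff (p *ᴾ 1ᴾ) w                              ≈⟨ coeff-*ᴾ p 1ᴾ w ⟩
      ∑[ t ∈ p ] (δ (proj₂ t ++ []) w (proj₁ t * 1#) + 0#)
        ≈⟨ ∑ˡ-cong p (λ t → trans (+-identityʳ _) (trans
             (reflexive (≡.cong (λ u → δ u w _) (++-identityʳ (proj₂ t))))
             (δ-cong (proj₂ t) w (*-identityʳ _)))) ⟩
      ∑[ t ∈ p ] δ (proj₂ t) w (proj₁ t)             ≈⟨ coeff-∑ p w ⟨
      coeff p w                                      ∎

    *ᴾ-zeroˡ : ∀ (p : NCPoly k) → 0ᴾ *ᴾ p ≃ 0ᴾ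
    *ᴾ-zeroˡ p = coeffwise λ _ → refl

    *ᴾ-zeroʳ : ∀ (p : NCPoly k) → p *ᴾ 0ᴾ ≃ 0ᴾ
    *ᴾ-zeroʳ p = coeffwise λ w → trans (coeff-*ᴾ p 0ᴾ w) (∑ˡ-zero p _ (λ _ → refl))

  NCPolySemiring : ℕ → Semiring c ℓ
  NCPolySemiring k = record
    { Carrier    = NCPoly k
    ; _≈_        = _≃_
    ; _+_        = _+ᴾ_
    ; _*_        = _*ᴾ_
    ; 0#         = 0ᴾ
    ; 1#         = 1ᴾ
    ; isSemiring = record
      { isSemiringWithoutAnnihilatingZero = record
        { +-isCommutativeMonoid = record
          { isMonoid = record
            { isSemigroup = record
              { isMagma = record { isEquivalence = ≃-isEquivalence ; ∙-cong = +ᴾ-cong }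
              ; assoc   = +ᴾ-assoc
              }
            ; identity = (λ _ → coeffwise λ _ → refl) , +ᴾ-identityʳ
            }
          ; comm = +ᴾ-comm
          }
        ; *-cong     = *ᴾ-cong
        ; *-assoc    = *ᴾ-assoc
        ; *-identity = *ᴾ-identityˡ , *ᴾ-identityʳ
        ; distrib    = *ᴾ-distribˡ , *ᴾ-distribʳ
        }
      ; zero = *ᴾ-zeroˡ , *ᴾ-zeroʳ
      }
    }

  module _ {k : ℕ} where

    *ᴾ-vanishesˡ : ∀ {p : NCPoly k} q → p ≃ 0ᴾ → p *ᴾ q ≃ 0ᴾ
    *ᴾ-vanishesˡ q p≃0 = coeffwise λ w → trans (coeff-≈ (*ᴾ-congˡ q p≃0) w) (coeff-≈ (*ᴾ-zeroˡ q) w)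

    *ᴾ-vanishesʳ : ∀ p {q : NCPoly k} → q ≃ 0ᴾ → p *ᴾ q ≃ 0ᴾ
    *ᴾ-vanishesʳ p q≃0 = coeffwise λ w → trans (coeff-≈ (*ᴾ-congʳ p q≃0) w) (coeff-≈ (*ᴾ-zeroʳ p) w)

    term-cong : ∀ (u : Word k) {a b} → a ≈ b → ((a , u) ∷ []) ≃ ((b , u) ∷ [])
    term-cong u {a} {b} a≈b = coeffwise λ w →
      trans (coeff-∑ ((a , u) ∷ []) w) (trans (+-congʳ (δ-cong u w a≈b)) (sym (coeff-∑ ((b , u) ∷ []) w)))

    coeff-absent : ∀ (p : NCPoly k) w → All (λ t → proj₂ t ≢ w) p → coeff p w ≈ 0#
    coeff-absent []            w []              = refl
    coeff-absent ((a , u) ∷ p) w (u≢w ∷ p∌w) with ≡-dec _≟ᶠ_ u w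
    ... | yes u≡w = contradiction u≡w u≢w
    ... | no _    = coeff-absent p w p∌w

    degreeAtMost : ∀ d (p : NCPoly k) → All (λ t → length (proj₂ t) ≤ d) p → DegreeAtMost d p
    degreeAtMost d p short w d<|w| =
      coeff-absent p w (All.map (λ |u|≤d u≡w → <⇒≱ d<|w| (≤-trans (≤-reflexive (≡.cong length (≡.sym u≡w))) |u|≤d)) short)

    constᴾ-zero : constᴾ {k} 0# ≃ 0ᴾ
    constᴾ-zero = coeffwise λ w → trans (coeff-∑ (constᴾ 0#) w) (trans (+-identityʳ _) (δ-zero [] w))

module Matrices {c ℓ} (F : Field c ℓ) (k N : ℕ) where
  private variable ℓ′ : Level
  open Over F
  open Polynomials F
  open Semiring (NCPolySemiring k) using (setoid)
    renaming (refl to ≃-refl; sym to ≃-sym; trans to ≃-trans)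
  open FiniteSums (NCPolySemiring k)
  open import Relation.Binary.Reasoning.Setoid setoid

  sumFin≡sum : ∀ {m} (h : Fin m → NCPoly k) → sumFin m h ≡ sum h
  sumFin≡sum {ℕ.zero}  h = ≡.refl
  sumFin≡sum {ℕ.suc m} h = ≡.cong (h zero +ᴾ_) (sumFin≡sum (h ∘ suc))

  *M-entry : ∀ (A B : Matrix k N) i j → (A *M B) i j ≃ sum (λ l → A i l *ᴾ B l j)
  *M-entry A B i j = ≃-reflexive (sumFin≡sum (λ l → A i l *ᴾ B l j))

  idM-diagonal : ∀ i → idM {k} {N} i i ≃ 1ᴾ
  idM-diagonal i with i ≟ᶠ i
  ... | yes _  = ≃-refl
  ... | no i≢i = contradiction ≡.refl i≢i

  idM-offDiagonal : ∀ {i j} → i ≢ j → idM {k} {N} i j ≃ 0ᴾ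
  idM-offDiagonal {i} {j} i≢j with i ≟ᶠ j
  ... | yes i≡j = contradiction i≡j i≢j
  ... | no _    = ≃-refl

  infix 4 _≈M_

  _≈M_ : Matrix k N → Matrix k N → Set ℓ
  A ≈M B = ∀ i j → A i j ≃ B i j

  *M-cong : ∀ {A A′ B B′} → A ≈M A′ → B ≈M B′ → (A *M B) ≈M (A′ *M B′)
  *M-cong {A} {A′} {B} {B′} A≈A′ B≈B′ i j = begin
    (A *M B) i j                ≈⟨ *M-entry A B i j ⟩
    sum (λ l → A i l *ᴾ B l j)   ≈⟨ sum-cong-≋ (λ l → *ᴾ-cong (A≈A′ i l) (B≈B′ l j)) ⟩
    sum (λ l → A′ i l *ᴾ B′ l j) ≈⟨ *M-entry A′ B′ i j ⟨
    (A′ *M B′) i j              ∎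

  *M-assoc : ∀ A B C → ((A *M B) *M C) ≈M (A *M (B *M C))
  *M-assoc A B C i j = begin
    ((A *M B) *M C) i j
      ≈⟨ ≃-trans (*M-entry (A *M B) C i j) (sum-cong-≋ (λ l → *ᴾ-congˡ (C l j) (*M-entry A B i l))) ⟩
    sum (λ l → sum (λ m → A i m *ᴾ B m l) *ᴾ C l j)
      ≈⟨ sum-cong-≋ (λ l → *-distribʳ-sum (C l j) (λ m → A i m *ᴾ B m l)) ⟩
    sum (λ l → sum (λ m → (A i m *ᴾ B m l) *ᴾ C l j))
      ≈⟨ ∑-comm (λ l m → (A i m *ᴾ B m l) *ᴾ C l j) ⟩
    sum (λ m → sum (λ l → (A i m *ᴾ B m l) *ᴾ C l j))
      ≈⟨ sum-cong-≋ (λ m → sum-cong-≋ (λ l → *ᴾ-assoc (A i m) (B m l) (C l j))) ⟩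
    sum (λ m → sum (λ l → A i m *ᴾ (B m l *ᴾ C l j)))
      ≈⟨ sum-cong-≋ (λ m → *-distribˡ-sum (A i m) (λ l → B m l *ᴾ C l j)) ⟨
    sum (λ m → A i m *ᴾ sum (λ l → B m l *ᴾ C l j))
      ≈⟨ ≃-trans (*M-entry A (B *M C) i j) (sum-cong-≋ (λ m → *ᴾ-congʳ (A i m) (*M-entry B C m j))) ⟨
    (A *M (B *M C)) i j ∎

  *M-identityˡ : ∀ A → (idM *M A) ≈M A
  *M-identityˡ A i j = begin
    (idM *M A) i j
      ≈⟨ *M-entry idM A i j ⟩
    sum (λ l → idM i l *ᴾ A l j)
      ≈⟨ sum-single _ i (λ l l≢i → *ᴾ-vanishesˡ (A l j) (idM-offDiagonal (l≢i ∘ ≡.sym))) ⟩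
    idM i i *ᴾ A i j
      ≈⟨ ≃-trans (*ᴾ-congˡ (A i j) (idM-diagonal i)) (*ᴾ-identityˡ (A i j)) ⟩
    A i j ∎

  *M-identityʳ : ∀ A → (A *M idM) ≈M A
  *M-identityʳ A i j = begin
    (A *M idM) i j              ≈⟨ *M-entry A idM i j ⟩
    sum (λ l → A i l *ᴾ idM l j) ≈⟨ sum-single _ j (λ l l≢j → *ᴾ-vanishesʳ (A i l) (idM-offDiagonal l≢j)) ⟩
    A i j *ᴾ idM j j             ≈⟨ ≃-trans (*ᴾ-congʳ (A i j) (idM-diagonal j)) (*ᴾ-identityʳ (A i j)) ⟩
    A i j                        ∎

  *M-distribˡ : ∀ A B C → (A *M (B +M C)) ≈M ((A *M B) +M (A *M C))
  *M-distribˡ A B C i j = begin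
    (A *M (B +M C)) i j
      ≈⟨ *M-entry A (B +M C) i j ⟩
    sum (λ l → A i l *ᴾ (B l j +ᴾ C l j))
      ≈⟨ sum-cong-≋ (λ l → *ᴾ-distribˡ (A i l) (B l j) (C l j)) ⟩
    sum (λ l → (A i l *ᴾ B l j) +ᴾ (A i l *ᴾ C l j))
      ≈⟨ ∑-distrib-+ {N} _ _ ⟩
    sum (λ l → A i l *ᴾ B l j) +ᴾ sum (λ l → A i l *ᴾ C l j)
      ≈⟨ +ᴾ-cong (*M-entry A B i j) (*M-entry A C i j) ⟨
    ((A *M B) +M (A *M C)) i j ∎

  *M-distribʳ : ∀ C A B → ((A +M B) *M C) ≈M ((A *M C) +M (B *M C))
  *M-distribʳ C A B i j = begin
    ((A +M B) *M C) i j
      ≈⟨ *M-entry (A +M B) C i j ⟩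
    sum (λ l → (A i l +ᴾ B i l) *ᴾ C l j)
      ≈⟨ sum-cong-≋ (λ l → *ᴾ-distribʳ (C l j) (A i l) (B i l)) ⟩
    sum (λ l → (A i l *ᴾ C l j) +ᴾ (B i l *ᴾ C l j))
      ≈⟨ ∑-distrib-+ {N} _ _ ⟩
    sum (λ l → A i l *ᴾ C l j) +ᴾ sum (λ l → B i l *ᴾ C l j)
      ≈⟨ +ᴾ-cong (*M-entry A C i j) (*M-entry B C i j) ⟨
    ((A *M C) +M (B *M C)) i j ∎

  *M-zeroʳ : ∀ A → (A *M zeroM) ≈M zeroM
  *M-zeroʳ A i j = ≃-trans (*M-entry A zeroM i j) (sum-zero N _ (λ l → *ᴾ-zeroʳ (A i l)))

  *M-zeroˡ : ∀ A → (zeroM *M A) ≈M zeroM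
  *M-zeroˡ A i j = ≃-trans (*M-entry zeroM A i j) (sum-zero N _ (λ l → *ᴾ-zeroˡ (A l j)))

  MatrixSemiring : Semiring c ℓ
  MatrixSemiring = record
    { Carrier    = Matrix k N
    ; _≈_        = _≈M_
    ; _+_        = _+M_
    ; _*_        = _*M_
    ; 0#         = zeroM
    ; 1#         = idM
    ; isSemiring = record
      { isSemiringWithoutAnnihilatingZero = record
        { +-isCommutativeMonoid = record
          { isMonoid = record
            { isSemigroup = record
              { isMagma = record
                { isEquivalence = record
                  { refl  = λ i j → ≃-refl
                  ; sym   = λ A≈B i j → ≃-sym (A≈B i j)
                  ; trans = λ A≈B B≈C i j → ≃-trans (A≈B i j) (B≈C i j)
                  }
                ; ∙-cong = λ A≈A′ B≈B′ i j → +ᴾ-cong (A≈A′ i j) (B≈B′ i j)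
                }
              ; assoc = λ A B C i j → +ᴾ-assoc (A i j) (B i j) (C i j)
              }
            ; identity = (λ A i j → ≃-refl) , (λ A i j → +ᴾ-identityʳ (A i j))
            }
          ; comm = λ A B i j → +ᴾ-comm (A i j) (B i j)
          }
        ; *-cong     = *M-cong
        ; *-assoc    = *M-assoc
        ; *-identity = *M-identityˡ , *M-identityʳ
        ; distrib    = *M-distribˡ , *M-distribʳ
        }
      ; zero = *M-zeroˡ , *M-zeroʳ
      }
    }

  *M-*M-single : ∀ (A M B : Matrix k N) {x y} i₀ l₀ →
                 (∀ i → i ≢ i₀ → A x i ≃ 0ᴾ) → (∀ l → l ≢ l₀ → B l y ≃ 0ᴾ) →
                 (A *M (M *M B)) x y ≃ A x i₀ *ᴾ (M i₀ l₀ *ᴾ B l₀ y)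
  *M-*M-single A M B {x} {y} i₀ l₀ row col = begin
    (A *M (M *M B)) x y
      ≈⟨ *M-entry A (M *M B) x y ⟩
    sum (λ i → A x i *ᴾ (M *M B) i y)
      ≈⟨ sum-single _ i₀ (λ i i≢i₀ → *ᴾ-vanishesˡ ((M *M B) i y) (row i i≢i₀)) ⟩
    A x i₀ *ᴾ (M *M B) i₀ y
      ≈⟨ *ᴾ-congʳ (A x i₀) (*M-entry M B i₀ y) ⟩
    A x i₀ *ᴾ sum (λ l → M i₀ l *ᴾ B l y)
      ≈⟨ *ᴾ-congʳ (A x i₀) (sum-single _ l₀ (λ l l≢l₀ → *ᴾ-vanishesʳ (M i₀ l) (col l l≢l₀))) ⟩
    A x i₀ *ᴾ (M i₀ l₀ *ᴾ B l₀ y) ∎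

  Triangular : Pred (Fin N) ℓ′ → Matrix k N → Set _
  Triangular P M = ∀ x y → ¬ P x → P y → M x y ≃ 0ᴾ

  *M-*M-vanishes : ∀ {P : Pred (Fin N) ℓ′} → Decidable P → ∀ {M} → Triangular P M →
                   ∀ (A B : Matrix k N) {x y} → (∀ i → P i → A x i ≃ 0ᴾ) → (∀ l → ¬ P l → B l y ≃ 0ᴾ) →
                   (A *M (M *M B)) x y ≃ 0ᴾ
  *M-*M-vanishes P? {M} M-triangular A B {x} {y} row col =
    ≃-trans (*M-entry A (M *M B) x y) (sum-zero N _ term-vanishes)
    where
    term-vanishes : ∀ i → A x i *ᴾ (M *M B) i y ≃ 0ᴾ
    term-vanishes i with P? i
    ... | yes Pi = *ᴾ-vanishesˡ _ (row i Pi)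
    ... | no ¬Pi = *ᴾ-vanishesʳ (A x i) (≃-trans (*M-entry M B i y) (sum-zero N _ inner-vanishes))
      where
      inner-vanishes : ∀ l → M i l *ᴾ B l y ≃ 0ᴾ
      inner-vanishes l with P? l
      ... | yes Pl = *ᴾ-vanishesˡ (B l y) (M-triangular i l ¬Pi Pl)
      ... | no ¬Pl = *ᴾ-vanishesʳ (M i l) (col l ¬Pl)

module MonomialsAtMatrices {c ℓ} (F : Field c ℓ) {k N r : ℕ} (Φ : Fin r → Over.Matrix F k N) where
  open Over F
  open Matrices F k N
  open Semiring MatrixSemiring using (setoid; sym; *-congˡ; *-assoc)
  open import Relation.Binary.Reasoning.Setoid setoid

  monomialAt : Word r → Matrix k N
  monomialAt u = foldr (λ y M → Φ y *M M) idM u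

  monomialAt-++ : ∀ u v → monomialAt (u ++ v) ≈M monomialAt u *M monomialAt v
  monomialAt-++ []      v = sym (*M-identityˡ (monomialAt v))
  monomialAt-++ (y ∷ u) v = begin
    Φ y *M monomialAt (u ++ v)             ≈⟨ *-congˡ {Φ y} (monomialAt-++ u v) ⟩
    Φ y *M (monomialAt u *M monomialAt v)  ≈⟨ *-assoc (Φ y) (monomialAt u) (monomialAt v) ⟨
    (Φ y *M monomialAt u) *M monomialAt v  ∎

module PalindromesAtMatrices {c ℓ} (F : Field c ℓ) {k N : ℕ} (Φ : Fin 2 → Over.Matrix F k N) where
  open Over F
  open Polynomials F
  open Matrices F k N
  open MonomialsAtMatrices F Φ public
  open Semiring MatrixSemiring using (setoid; refl; sym; trans; *-congˡ; *-congʳ; +-cong; *-identityʳ)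
  open Semiring (NCPolySemiring k) using () renaming (trans to ≃-trans)
  open FiniteSums MatrixSemiring using (∑ˡ; ∑ˡ-cong; ∑ˡ-distrib-+; *-distribˡ-∑ˡ; *-distribʳ-∑ˡ; ∑ˡ-concatMap)
  open import Relation.Binary.Reasoning.Setoid setoid

  PAL-at : ℕ → Matrix k N
  PAL-at m = evalAtMatrices (poly PAL m) Φ

  sandwich : Fin 2 → Matrix k N → Matrix k N
  sandwich b X = Φ b *M (X *M Φ b)

  evalAt-unitCoefficients : ∀ (f : Word 2 → Word 2) ws →
    evalAtMatrices (map (λ w → (Field.1# F , f w)) ws) Φ ≈M ∑[ w ∈ ws ] monomialAt (f w)
  evalAt-unitCoefficients f []       = refl
  evalAt-unitCoefficients f (w ∷ ws) =
    +-cong (λ i j → *ᴾ-identityˡ (monomialAt (f w) i j)) (evalAt-unitCoefficients f ws)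

  monomialAt-palindrome-∷ : ∀ b w →
    monomialAt ((b ∷ w) ++ reverse (b ∷ w)) ≈M sandwich b (monomialAt (w ++ reverse w))
  monomialAt-palindrome-∷ b w = begin
    Φ b *M monomialAt (w ++ reverse (b ∷ w))
      ≡⟨ ≡.cong (λ u → Φ b *M monomialAt u)
           (≡.trans (≡.cong (w ++_) (unfold-reverse b w)) (≡.sym (++-assoc w (reverse w) _))) ⟩
    Φ b *M monomialAt ((w ++ reverse w) ++ b ∷ [])
      ≈⟨ *-congˡ {Φ b} (monomialAt-++ (w ++ reverse w) (b ∷ [])) ⟩
    Φ b *M (monomialAt (w ++ reverse w) *M (Φ b *M idM))
      ≈⟨ *-congˡ {Φ b} (*-congˡ {monomialAt (w ++ reverse w)} (*-identityʳ (Φ b))) ⟩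
    sandwich b (monomialAt (w ++ reverse w)) ∎

  sandwich-∑ˡ : ∀ b (ws : List (Word 2)) (f : Word 2 → Matrix k N) →
                ∑[ w ∈ ws ] sandwich b (f w) ≈M sandwich b (∑ˡ ws f)
  sandwich-∑ˡ b ws f = begin
    ∑[ w ∈ ws ] Φ b *M (f w *M Φ b) ≈⟨ *-distribˡ-∑ˡ ws (Φ b) _ ⟨
    Φ b *M (∑[ w ∈ ws ] f w *M Φ b) ≈⟨ *-congˡ {Φ b} (*-distribʳ-∑ˡ ws (Φ b) f) ⟨
    sandwich b (∑ˡ ws f)            ∎

  PAL-at-zero : PAL-at 0 ≈M idM
  PAL-at-zero i j = ≃-trans (+ᴾ-identityʳ _) (*ᴾ-identityˡ (idM i j))

  PAL-at-suc : ∀ m → PAL-at (ℕ.suc m) ≈M sandwich zero (PAL-at m) +M sandwich (suc zero) (PAL-at m)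
  PAL-at-suc m = begin
    PAL-at (ℕ.suc m)
      ≈⟨ evalAt-unitCoefficients palindrome (allWords (ℕ.suc m)) ⟩
    ∑[ v ∈ allWords (ℕ.suc m) ] monomialAt (palindrome v)
      ≈⟨ ∑ˡ-concatMap _ ws _ ⟩
    ∑[ w ∈ ws ] (monomialAt (palindrome (zero ∷ w)) +M (monomialAt (palindrome (suc zero ∷ w)) +M zeroM))
      ≈⟨ ∑ˡ-cong ws (λ w → +-cong (monomialAt-palindrome-∷ zero w)
                                  (trans (λ i j → +ᴾ-identityʳ _) (monomialAt-palindrome-∷ (suc zero) w))) ⟩
    ∑[ w ∈ ws ] (sandwich zero (monomialAt (palindrome w)) +M sandwich (suc zero) (monomialAt (palindrome w)))
      ≈⟨ ∑ˡ-distrib-+ ws _ _ ⟩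
    (∑[ w ∈ ws ] sandwich zero (monomialAt (palindrome w))) +M (∑[ w ∈ ws ] sandwich (suc zero) (monomialAt (palindrome w)))
      ≈⟨ +-cong (sandwich-∑ˡ zero ws _) (sandwich-∑ˡ (suc zero) ws _) ⟩
    sandwich zero (∑ˡ ws (monomialAt ∘ palindrome)) +M sandwich (suc zero) (∑ˡ ws (monomialAt ∘ palindrome))
      ≈⟨ +-cong (sandwich-cong zero back) (sandwich-cong (suc zero) back) ⟩
    sandwich zero (PAL-at m) +M sandwich (suc zero) (PAL-at m) ∎
    where
    ws = allWords m
    palindrome : Word 2 → Word 2
    palindrome w = w ++ reverse w
    back : ∑ˡ ws (monomialAt ∘ palindrome) ≈M PAL-at m
    back = sym (evalAt-unitCoefficients palindrome ws)
    sandwich-cong : ∀ b {X Y} → X ≈M Y → sandwich b X ≈M sandwich b Y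
    sandwich-cong b X≈Y = *-congˡ {Φ b} (*-congʳ {Φ b} X≈Y)

  PAL-at-triangular : ∀ {ℓ′} {P : Pred (Fin N) ℓ′} → Decidable P → (∀ b → Triangular P (Φ b)) →
                      ∀ m → Triangular P (PAL-at m)
  PAL-at-triangular {P = P} P? Φ-triangular ℕ.zero x y ¬Px Py =
    ≃-trans (PAL-at-zero x y) (idM-offDiagonal (λ x≡y → ¬Px (≡.subst P (≡.sym x≡y) Py)))
  PAL-at-triangular P? Φ-triangular (ℕ.suc m) x y ¬Px Py =
    ≃-trans (PAL-at-suc m x y) (+ᴾ-cong (vanishes zero) (vanishes (suc zero)))
    where
    vanishes : ∀ b → sandwich b (PAL-at m) x y ≃ 0ᴾ
    vanishes b = *M-*M-vanishes P? (PAL-at-triangular P? Φ-triangular m) (Φ b) (Φ b)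
                   (λ i Pi → Φ-triangular b x i ¬Px Pi) (λ l ¬Pl → Φ-triangular b l y ¬Pl Py)

module PalindromesInVSK {c ℓ} (F : Field c ℓ) where
  open import Data.Nat using (_+_; _*_; _^_)
  open import Data.Nat.Properties using (*-comm)
  open Field F using (1#; *-identityʳ) renaming (_*_ to _·_)
  open Over F
  open Polynomials F
  open Semiring (NCPolySemiring 2) using (setoid; refl; sym; trans; +-cong; *-congˡ; *-congʳ; *-assoc)
  open import Relation.Binary.Reasoning.Setoid setoid

  variables : Fin 2 → Matrix 2 1
  variables b _ _ = varᴾ b

  open Matrices F 2 1
  open PalindromesAtMatrices F variables

  monomialAt-variables : ∀ u → monomialAt u zero zero ≃ (1# , u) ∷ []
  monomialAt-variables []      = idM-diagonal zero
  monomialAt-variables (b ∷ u) = begin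
    (varᴾ b *ᴾ monomialAt u zero zero) +ᴾ 0ᴾ  ≈⟨ +ᴾ-identityʳ _ ⟩
    varᴾ b *ᴾ monomialAt u zero zero          ≈⟨ *-congˡ {varᴾ b} (monomialAt-variables u) ⟩
    (1# · 1# , b ∷ u) ∷ []                    ≈⟨ term-cong (b ∷ u) (*-identityʳ 1#) ⟩
    (1# , b ∷ u) ∷ []                         ∎

  evalAt-variables : ∀ g → evalAtMatrices g variables zero zero ≃ g
  evalAt-variables []            = refl
  evalAt-variables ((a , w) ∷ g) = +-cong single (evalAt-variables g)
    where
    single : scaleᴾ a (monomialAt w zero zero) ≃ (a , w) ∷ []
    single = begin
      scaleᴾ a (monomialAt w zero zero) ≈⟨ *-congˡ {constᴾ a} (monomialAt-variables w) ⟩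
      (a · 1# , w) ∷ [] ++ []           ≈⟨ +ᴾ-identityʳ _ ⟩
      (a · 1# , w) ∷ []                 ≈⟨ term-cong w (*-identityʳ a) ⟩
      (a , w) ∷ []                      ∎

  enclose : Fin 2 → NCPoly 2 → NCPoly 2
  enclose b p = (varᴾ b *ᴾ p) *ᴾ varᴾ b

  PAL-suc : ∀ n → poly PAL (ℕ.suc n) ≃ enclose zero (poly PAL n) +ᴾ enclose (suc zero) (poly PAL n)
  PAL-suc n = begin
    poly PAL (ℕ.suc n)          ≈⟨ evalAt-variables (poly PAL (ℕ.suc n)) ⟨
    PAL-at (ℕ.suc n) zero zero  ≈⟨ PAL-at-suc n zero zero ⟩
    sandwich zero (PAL-at n) zero zero +ᴾ sandwich (suc zero) (PAL-at n) zero zero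
                                ≈⟨ +-cong (sandwich-variables zero) (sandwich-variables (suc zero)) ⟩
    enclose zero (poly PAL n) +ᴾ enclose (suc zero) (poly PAL n) ∎
    where
    only : ∀ {a} {A : Set a} (i : Fin 1) → i ≢ zero → A
    only zero 0≢0 = contradiction ≡.refl 0≢0
    sandwich-variables : ∀ b → sandwich b (PAL-at n) zero zero ≃ enclose b (poly PAL n)
    sandwich-variables b = begin
      sandwich b (PAL-at n) zero zero
        ≈⟨ *M-*M-single (variables b) (PAL-at n) (variables b) {zero} {zero} zero zero only only ⟩
      varᴾ b *ᴾ (PAL-at n zero zero *ᴾ varᴾ b)
        ≈⟨ *-congˡ {varᴾ b} (*-congʳ {varᴾ b} (evalAt-variables (poly PAL n))) ⟩
      varᴾ b *ᴾ (poly PAL n *ᴾ varᴾ b)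
        ≈⟨ *-assoc (varᴾ b) (poly PAL n) (varᴾ b) ⟨
      enclose b (poly PAL n) ∎

  -- The five gates added per level compute x₀P, x₀Px₀, x₁P, x₁Px₁ and x₀Px₀ + x₁Px₁ from the previous output P.
  palindromeGates : (n : ℕ) → Gates 2 (ℕ.suc (n * 5))
  palindromeGates ℕ.zero    = [] ▷ inp (cst 1#)
  palindromeGates (ℕ.suc n) =
    ((((palindromeGates n ▷ mulL (var zero) zero) ▷ mulR zero (var zero))
      ▷ mulL (var (suc zero)) (suc (suc zero))) ▷ mulR zero (var (suc zero)))
      ▷ add (suc (suc zero)) zero

  palindromeGates-correct : ∀ n → evalGates (palindromeGates n) zero ≃ poly PAL n
  palindromeGates-correct ℕ.zero    = refl
  palindromeGates-correct (ℕ.suc n) =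
    trans (+-cong (enclose-cong zero) (enclose-cong (suc zero))) (sym (PAL-suc n))
    where
    enclose-cong : ∀ b → enclose b (evalGates (palindromeGates n) zero) ≃ enclose b (poly PAL n)
    enclose-cong b = *-congʳ {varᴾ b} (*-congˡ {varᴾ b} (palindromeGates-correct n))

  allWords-length : ∀ n → All (λ w → length w ≡ n) (allWords {2} n)
  allWords-length ℕ.zero    = ≡.refl ∷ []
  allWords-length (ℕ.suc n) =
    concat⁺ (gmap⁺ (λ |w|≡n → ≡.cong ℕ.suc |w|≡n ∷ ≡.cong ℕ.suc |w|≡n ∷ []) (allWords-length n))

  PAL-degree : ∀ n → DegreeAtMost (n + n) (poly PAL n)
  PAL-degree n = degreeAtMost (n + n) (poly PAL n) (gmap⁺ (λ {w} → palindrome-length {w}) (allWords-length n))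
    where
    palindrome-length : ∀ {w : Word 2} → length w ≡ n → length (w ++ reverse w) ≤ n + n
    palindrome-length {w} |w|≡n = ≤-reflexive (≡.trans (length-++ w)
      (≡.cong₂ _+_ |w|≡n (≡.trans (length-reverse w) |w|≡n)))

  *5≤^6+5 : ∀ n → n * 5 ≤ n ^ 6 + 5
  *5≤^6+5 0 = z≤n
  *5≤^6+5 1 = n≤1+n 5
  *5≤^6+5 n@(ℕ.suc (ℕ.suc _)) =
    ≤-trans (*-monoʳ-≤ n (≤-trans (m≤m+n 5 27) (^-monoˡ-≤ 5 {2} {n} (s≤s (s≤s z≤n))))) (m≤m+n (n ^ 6) 5)

  PAL-isPFamily : IsPFamily PAL
  PAL-isPFamily = 6 , λ n → ≤-trans (m≤m+n 2 4) (m≤n+m 6 (n ^ 6))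
                          , λ w 6<|w| → PAL-degree n w (≤-trans (s≤s (n+n≤^6+6 n)) 6<|w|)
    where
    n+n≤^6+6 : ∀ n → n + n ≤ n ^ 6 + 6
    n+n≤^6+6 n = ≤-trans (+-monoʳ-≤ n (m≤m+n n _)) (≤-trans (≤-reflexive (*-comm 5 n))
      (≤-trans (*5≤^6+5 n) (+-monoʳ-≤ (n ^ 6) (n≤1+n 5))))

  PAL-circuits : ∀ n → SkewCircuitOfSize (n ^ 6 + 6) (poly PAL n)
  PAL-circuits n = n * 5 , ≤-trans (s≤s (*5≤^6+5 n)) (≤-reflexive (≡.sym (+-suc (n ^ 6) 5)))
                 , palindromeGates n , coeff-≈ (palindromeGates-correct n)

  PAL∈VSK : VSKnc PAL
  PAL∈VSK = PAL-isPFamily , 6 , PAL-circuits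

module Circuits {c ℓ} (F : Field c ℓ) where
  open Over F

  weakenGate : ∀ {k i} → Gate k i → Gate k (ℕ.suc i)
  weakenGate (inp a)    = inp a
  weakenGate (add j l)  = add (suc j) (suc l)
  weakenGate (mulL a j) = mulL a (suc j)
  weakenGate (mulR j a) = mulR (suc j) a

  evalGate : ∀ {k i} → (Fin i → NCPoly k) → Gate k i → NCPoly k
  evalGate v (inp a)    = evalInput a
  evalGate v (add j l)  = v j +ᴾ v l
  evalGate v (mulL a j) = evalInput a *ᴾ v j
  evalGate v (mulR j a) = v j *ᴾ evalInput a

  evalGate-weaken : ∀ {k i} (v : Fin (ℕ.suc i) → NCPoly k) (g : Gate k i) →
                    evalGate v (weakenGate g) ≡ evalGate (v ∘ suc) g
  evalGate-weaken v (inp a)    = ≡.refl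
  evalGate-weaken v (add j l)  = ≡.refl
  evalGate-weaken v (mulL a j) = ≡.refl
  evalGate-weaken v (mulR j a) = ≡.refl

  evalGates-last : ∀ {k i} (gs : Gates k i) (g : Gate k i) → evalGates (gs ▷ g) zero ≡ evalGate (evalGates gs) g
  evalGates-last gs (inp a)    = ≡.refl
  evalGates-last gs (add j l)  = ≡.refl
  evalGates-last gs (mulL a j) = ≡.refl
  evalGates-last gs (mulR j a) = ≡.refl

  -- Gate j of the circuit, with its children numbered as gates of the whole circuit.
  gateAt : ∀ {k s} → Gates k s → Fin s → Gate k s
  gateAt (gs ▷ g) zero    = weakenGate g
  gateAt (gs ▷ g) (suc j) = weakenGate (gateAt gs j)

  evalGates-gateAt : ∀ {k s} (gs : Gates k s) j → evalGates gs j ≡ evalGate (evalGates gs) (gateAt gs j)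
  evalGates-gateAt (gs ▷ g) zero    = ≡.trans (evalGates-last gs g) (≡.sym (evalGate-weaken (evalGates (gs ▷ g)) g))
  evalGates-gateAt (gs ▷ g) (suc j) =
    ≡.trans (evalGates-gateAt gs j) (≡.sym (evalGate-weaken (evalGates (gs ▷ g)) (gateAt gs j)))

  ChildrenAbove : ∀ {k s} → Fin s → Gate k s → Set
  ChildrenAbove j (inp a)    = ⊤
  ChildrenAbove j (add c l)  = j Fin.< c × j Fin.< l
  ChildrenAbove j (mulL a c) = j Fin.< c
  ChildrenAbove j (mulR c a) = j Fin.< c

  weakenGate-childrenAbove : ∀ {k i} (g : Gate k i) → ChildrenAbove zero (weakenGate g)
  weakenGate-childrenAbove (inp a)    = tt
  weakenGate-childrenAbove (add j l)  = s≤s z≤n , s≤s z≤n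
  weakenGate-childrenAbove (mulL a j) = s≤s z≤n
  weakenGate-childrenAbove (mulR j a) = s≤s z≤n

  weakenGate-childrenAbove-suc : ∀ {k i} {j : Fin i} (g : Gate k i) →
                                 ChildrenAbove j g → ChildrenAbove (suc j) (weakenGate g)
  weakenGate-childrenAbove-suc (inp a)    _           = tt
  weakenGate-childrenAbove-suc (add c l)  (j<c , j<l) = s≤s j<c , s≤s j<l
  weakenGate-childrenAbove-suc (mulL a c) j<c         = s≤s j<c
  weakenGate-childrenAbove-suc (mulR c a) j<c         = s≤s j<c

  gateAt-childrenAbove : ∀ {k s} (gs : Gates k s) j → ChildrenAbove j (gateAt gs j)
  gateAt-childrenAbove (gs ▷ g) zero    = weakenGate-childrenAbove g
  gateAt-childrenAbove (gs ▷ g) (suc j) = weakenGate-childrenAbove-suc (gateAt gs j) (gateAt-childrenAbove gs j)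

data Node (s : ℕ) : Set where
  top bot : Fin s → Node s
  mid     : Node s

module NodeEncoding {s′ S Q : ℕ} (s≤S : ℕ.suc s′ ≤ S) (S+S≤Q : S ℕ.+ S ≤ Q) where
  open import Data.Nat using (_<?_; _≟_)

  s : ℕ
  s = ℕ.suc s′

  toℕ<S : (j : Fin s) → toℕ j < S
  toℕ<S j = <-≤-trans (toℕ<n j) s≤S

  S≤Q : S ≤ Q
  S≤Q = ≤-trans (m≤m+n S S) S+S≤Q

  S<Q∸toℕ : (j : Fin s) → S < Q ∸ toℕ j
  S<Q∸toℕ j = m+n≤o⇒m≤o∸n (ℕ.suc S) (<-≤-trans (+-monoʳ-< S (toℕ<S j)) S+S≤Q)

  Q∸[Q∸toℕ]≡toℕ : (j : Fin s) → Q ∸ (Q ∸ toℕ j) ≡ toℕ j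
  Q∸[Q∸toℕ]≡toℕ j = m∸[m∸n]≡n (≤-trans (<⇒≤ (toℕ<S j)) S≤Q)

  -- bot zero is the last index Q, so the output gate lands in the entry (zero, Q);
  -- indices that code no node stay unused.
  codeℕ : Node s → ℕ
  codeℕ (top j) = toℕ j
  codeℕ mid     = S
  codeℕ (bot j) = Q ∸ toℕ j

  codeℕ≤Q : ∀ t → codeℕ t ≤ Q
  codeℕ≤Q (top j) = ≤-trans (<⇒≤ (toℕ<S j)) S≤Q
  codeℕ≤Q mid     = S≤Q
  codeℕ≤Q (bot j) = m∸n≤m Q (toℕ j)

  code : Node s → Fin (ℕ.suc Q)
  code t = fromℕ< (s≤s (codeℕ≤Q t))

  decodeℕ : ℕ → Maybe (Node s)
  decodeℕ n with n <? s
  ... | yes n<s = just (top (fromℕ< n<s))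
  ... | no _ with n ≟ S
  ...   | yes _ = just mid
  ...   | no _ with Q ∸ n <? s
  ...     | yes Q∸n<s = just (bot (fromℕ< Q∸n<s))
  ...     | no _      = nothing

  decode : Fin (ℕ.suc Q) → Maybe (Node s)
  decode x = decodeℕ (toℕ x)

  decodeℕ-codeℕ : ∀ t → decodeℕ (codeℕ t) ≡ just t
  decodeℕ-codeℕ (top j) with toℕ j <? s
  ... | yes j<s = ≡.cong (just ∘ top) (toℕ-injective (toℕ-fromℕ< j<s))
  ... | no j≮s  = contradiction (toℕ<n j) j≮s
  decodeℕ-codeℕ mid with S <? s
  ... | yes S<s = contradiction S<s (≤⇒≯ s≤S)
  ... | no _ with S ≟ S
  ...   | yes _  = ≡.refl
  ...   | no S≢S = contradiction ≡.refl S≢S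
  decodeℕ-codeℕ (bot j) with Q ∸ toℕ j <? s
  ... | yes Q∸j<s = contradiction Q∸j<s (≤⇒≯ (≤-trans s≤S (<⇒≤ (S<Q∸toℕ j))))
  ... | no _ with Q ∸ toℕ j ≟ S
  ...   | yes Q∸j≡S = contradiction (≡.sym Q∸j≡S) (<⇒≢ (S<Q∸toℕ j))
  ...   | no _ with Q ∸ (Q ∸ toℕ j) <? s
  ...     | yes Q∸[Q∸j]<s =
    ≡.cong (just ∘ bot) (toℕ-injective (≡.trans (toℕ-fromℕ< Q∸[Q∸j]<s) (Q∸[Q∸toℕ]≡toℕ j)))
  ...     | no Q∸[Q∸j]≮s  = contradiction (≡.subst (_< s) (≡.sym (Q∸[Q∸toℕ]≡toℕ j)) (toℕ<n j)) Q∸[Q∸j]≮s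

  decode-code : ∀ t → decode (code t) ≡ just t
  decode-code t = ≡.trans (≡.cong decodeℕ (toℕ-fromℕ< (s≤s (codeℕ≤Q t)))) (decodeℕ-codeℕ t)

  ≢-code : ∀ {y t t′} → decode y ≡ just t → t ≢ t′ → y ≢ code t′
  ≢-code {t′ = t′} y↦t t≢t′ ≡.refl = t≢t′ (just-injective (≡.trans (≡.sym y↦t) (decode-code t′)))

  code-≢ : ∀ {t t′} → t ≢ t′ → code t ≢ code t′
  code-≢ {t} = ≢-code (decode-code t)

  decodeℕ-mid : ∀ n → decodeℕ n ≡ just mid → n ≡ S
  decodeℕ-mid n eq with n <? s
  ... | yes _ with () ← eq
  ... | no _ with n ≟ S
  ...   | yes n≡S = n≡S
  ...   | no _ with Q ∸ n <? s
  ...     | yes _ with () ← eq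
  ...     | no _  with () ← eq

  decode-mid : ∀ x → decode x ≡ just mid → x ≡ code mid
  decode-mid x eq = toℕ-injective (≡.trans (decodeℕ-mid (toℕ x) eq) (≡.sym (toℕ-fromℕ< (s≤s S≤Q))))

  code-bot-zero : code (bot zero) ≡ fromℕ Q
  code-bot-zero = toℕ-injective (≡.trans (toℕ-fromℕ< (s≤s (codeℕ≤Q (bot zero)))) (≡.sym (toℕ-fromℕ Q)))

  IsTop : Fin (ℕ.suc Q) → Set
  IsTop x = ∃ λ j → decode x ≡ just (top j)

  top? : Decidable IsTop
  top? x with decode x
  ... | just (top j) = yes (j , ≡.refl)
  ... | just (bot j) = no λ ()
  ... | just mid     = no λ ()
  ... | nothing      = no λ ()

  ¬top-mid : ¬ IsTop (code mid)
  ¬top-mid (j , mid↦top) = ≢-code {t′ = mid} mid↦top (λ ()) ≡.refl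

module Wiring {c ℓ} (F : Field c ℓ) {k s : ℕ} where
  open Over F
  open Field F using (0#; 1#)
  open Polynomials F
  open Circuits F
  open Semiring (NCPolySemiring k) using (setoid; refl; trans; reflexive; +-cong; *-congˡ; *-identityˡ; *-identityʳ)
  open import Relation.Binary.Reasoning.Setoid setoid

  data Port : Set where
    gate : Fin s → Port
    one  : Port

  entry exit : Port → Node s
  entry (gate c) = top c
  entry one      = mid
  exit (gate c) = bot c
  exit one      = mid

  bot≢entry : ∀ j p → bot j ≢ entry p
  bot≢entry j (gate c) ()
  bot≢entry j one      ()

  mid≢entry : ∀ {p} → p ≢ one → mid ≢ entry p
  mid≢entry {gate c} _     ()
  mid≢entry {one}    p≢one _ = p≢one ≡.refl

  record Wire : Set c where
    constructor wire⟨_,_,_⟩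
    field
      left  : Entry k
      port  : Port
      right : Entry k
  open Wire public

  toEntry : Input k → Entry k
  toEntry (var x) = xv x
  toEntry (cst a) = fe a

  evalEntry-toEntry : ∀ a → evalEntry (toEntry a) ≡ evalInput a
  evalEntry-toEntry (var x) = ≡.refl
  evalEntry-toEntry (cst a) = ≡.refl

  -- In the matrix substituted for the variable b, gate j is linked to a port by the edges
  -- top j → entry (port w) and exit (port w) → bot j, labelled left w and right w, where w = wire b j g.
  wire : Fin 2 → Fin s → Gate k s → Wire
  wire zero       j (inp a)    = wire⟨ fe 0#     , gate j , fe 0#     ⟩
  wire zero       j (add c l)  = wire⟨ fe 1#     , gate c , fe 1#     ⟩
  wire zero       j (mulL a c) = wire⟨ toEntry a , gate c , fe 1#     ⟩
  wire zero       j (mulR c a) = wire⟨ fe 1#     , gate c , toEntry a ⟩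
  wire (suc zero) j (inp a)    = wire⟨ toEntry a , one    , fe 1#     ⟩
  wire (suc zero) j (add c l)  = wire⟨ fe 1#     , gate l , fe 1#     ⟩
  wire (suc zero) j (mulL a c) = wire⟨ fe 0#     , one    , fe 0#     ⟩
  wire (suc zero) j (mulR c a) = wire⟨ fe 0#     , one    , fe 0#     ⟩

  wire-zero-port : ∀ j g → port (wire zero j g) ≢ one
  wire-zero-port j (inp a)    ()
  wire-zero-port j (add c l)  ()
  wire-zero-port j (mulL a c) ()
  wire-zero-port j (mulR c a) ()

  along : (Port → NCPoly k) → Wire → NCPoly k
  along V w = evalEntry (left w) *ᴾ (V (port w) *ᴾ evalEntry (right w))

  along-wires-correct : ∀ (V : Port → NCPoly k) (v : Fin s → NCPoly k) j g → ChildrenAbove j g →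
                        V one ≃ 1ᴾ → (∀ c → j Fin.< c → V (gate c) ≃ v c) →
                        along V (wire zero j g) +ᴾ along V (wire (suc zero) j g) ≃ evalGate v g
  along-wires-correct V v j (inp a) _ V-one _ = begin
    along V (wire zero j (inp a)) +ᴾ along V (wire (suc zero) j (inp a))
                                         ≈⟨ +-cong (*ᴾ-vanishesˡ _ constᴾ-zero) refl ⟩
    evalEntry (toEntry a) *ᴾ (V one *ᴾ 1ᴾ) ≈⟨ *-congˡ {evalEntry (toEntry a)} (trans (*-identityʳ (V one)) V-one) ⟩
    evalEntry (toEntry a) *ᴾ 1ᴾ            ≈⟨ *-identityʳ _ ⟩
    evalEntry (toEntry a)                 ≡⟨ evalEntry-toEntry a ⟩
    evalInput a                           ∎
  along-wires-correct V v j (add c l) (j<c , j<l) _ V-gate = +-cong (through c j<c) (through l j<l)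
    where
    through : ∀ c → j Fin.< c → 1ᴾ *ᴾ (V (gate c) *ᴾ 1ᴾ) ≃ v c
    through c j<c = trans (*-identityˡ _) (trans (*-identityʳ _) (V-gate c j<c))
  along-wires-correct V v j (mulL a c) j<c _ V-gate = begin
    along V (wire zero j (mulL a c)) +ᴾ along V (wire (suc zero) j (mulL a c))
      ≈⟨ +-cong refl (*ᴾ-vanishesˡ _ constᴾ-zero) ⟩
    (evalEntry (toEntry a) *ᴾ (V (gate c) *ᴾ 1ᴾ)) +ᴾ 0ᴾ
      ≈⟨ +ᴾ-identityʳ _ ⟩
    evalEntry (toEntry a) *ᴾ (V (gate c) *ᴾ 1ᴾ)
      ≈⟨ *ᴾ-cong (reflexive (evalEntry-toEntry a)) (trans (*-identityʳ _) (V-gate c j<c)) ⟩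
    evalInput a *ᴾ v c ∎
  along-wires-correct V v j (mulR c a) j<c _ V-gate = begin
    along V (wire zero j (mulR c a)) +ᴾ along V (wire (suc zero) j (mulR c a))
      ≈⟨ +-cong refl (*ᴾ-vanishesˡ _ constᴾ-zero) ⟩
    (1ᴾ *ᴾ (V (gate c) *ᴾ evalEntry (toEntry a))) +ᴾ 0ᴾ
      ≈⟨ trans (+ᴾ-identityʳ _) (*-identityˡ _) ⟩
    V (gate c) *ᴾ evalEntry (toEntry a)
      ≈⟨ *ᴾ-cong (V-gate c j<c) (reflexive (evalEntry-toEntry a)) ⟩
    v c *ᴾ evalInput a ∎

module SkewCircuitToPalindromes {c ℓ} (F : Field c ℓ) {k s′ : ℕ} (gs : Over.Gates F k (ℕ.suc s′))
                                {S Q : ℕ} (s≤S : ℕ.suc s′ ≤ S) (S+S≤Q : S ℕ.+ S ≤ Q) where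
  open import Data.Nat using (_+_)
  open import Data.Nat.Properties using (+-identityʳ)
  open Over F
  open Field F using (0#; 1#)
  open Polynomials F
  open Circuits F
  open NodeEncoding s≤S S+S≤Q
  open Wiring F {k} {s}
  open Matrices F k (ℕ.suc Q) using (Triangular; *M-*M-single; *M-*M-vanishes; idM-diagonal)
  open Semiring (NCPolySemiring k) using (setoid; refl; trans; reflexive; +-cong; *-identityˡ; *-identityʳ)
  open import Relation.Binary.Reasoning.Setoid setoid

  N : ℕ
  N = ℕ.suc Q

  wireAt : Fin 2 → Fin s → Wire
  wireAt b j = wire b j (gateAt gs j)

  δE : Fin N → Fin N → Entry k → Entry k
  δE y y₀ e with y ≟ᶠ y₀
  ... | yes _ = e
  ... | no  _ = fe 0#

  δE-same : ∀ y e → evalEntry (δE y y e) ≡ evalEntry e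
  δE-same y e with y ≟ᶠ y
  ... | yes _  = ≡.refl
  ... | no y≢y = contradiction ≡.refl y≢y

  δE-other : ∀ {y y₀} e → y ≢ y₀ → evalEntry (δE y y₀ e) ≃ 0ᴾ
  δE-other {y} {y₀} e y≢y₀ with y ≟ᶠ y₀
  ... | yes y≡y₀ = contradiction y≡y₀ y≢y₀
  ... | no _     = constᴾ-zero

  -- The rows of top nodes and the columns of bot nodes carry the wires; the variable zero also has a loop at mid.
  entryAt : Fin 2 → Fin N → Fin N → Maybe (Node s) → Maybe (Node s) → Entry k
  entryAt b    x y (just (top j)) _              = δE y (code (entry (port (wireAt b j)))) (left (wireAt b j))
  entryAt zero x y (just mid)     _              = δE y (code mid) (fe 1#)
  entryAt b    x y _              (just (bot j)) = δE x (code (exit (port (wireAt b j)))) (right (wireAt b j))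
  entryAt b    x y _              _              = fe 0#

  φ : Fin 2 → Fin N → Fin N → Entry k
  φ b x y = entryAt b x y (decode x) (decode y)

  Φ : Fin 2 → Matrix k N
  Φ b x y = evalEntry (φ b x y)

  Φ-at : ∀ b x y {dx dy} → decode x ≡ dx → decode y ≡ dy → Φ b x y ≡ evalEntry (entryAt b x y dx dy)
  Φ-at b x y ≡.refl ≡.refl = ≡.refl

  Φ-vanishes-at : ∀ b x y {dx dy} → decode x ≡ dx → decode y ≡ dy →
                  evalEntry (entryAt b x y dx dy) ≃ 0ᴾ → Φ b x y ≃ 0ᴾ
  Φ-vanishes-at b x y x↦ y↦ = trans (reflexive (Φ-at b x y x↦ y↦))

  row-top : ∀ b j y → y ≢ code (entry (port (wireAt b j))) → Φ b (code (top j)) y ≃ 0ᴾ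
  row-top b j y y≢ = Φ-vanishes-at b (code (top j)) y (decode-code (top j)) ≡.refl (δE-other _ y≢)

  row-top-at : ∀ b j → Φ b (code (top j)) (code (entry (port (wireAt b j)))) ≡ evalEntry (left (wireAt b j))
  row-top-at b j = ≡.trans (Φ-at b (code (top j)) _ (decode-code (top j)) ≡.refl) (δE-same _ _)

  col-bot : ∀ b j x → x ≢ code (exit (port (wireAt b j))) → Φ b x (code (bot j)) ≃ 0ᴾ
  col-bot b j x x≢ = vanishes b (decode x) ≡.refl x≢
    where
    vanishes : ∀ b dx → decode x ≡ dx → x ≢ code (exit (port (wireAt b j))) → Φ b x (code (bot j)) ≃ 0ᴾ
    vanishes b (just (top j′)) x↦ _ =
      Φ-vanishes-at b x _ x↦ (decode-code (bot j)) (δE-other _ (code-≢ (bot≢entry j (port (wireAt b j′)))))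
    vanishes zero (just mid) x↦ _ =
      Φ-vanishes-at zero x _ x↦ (decode-code (bot j)) (δE-other _ (code-≢ {bot j} {mid} λ ()))
    vanishes (suc zero) (just mid) x↦ x≢ = Φ-vanishes-at (suc zero) x _ x↦ (decode-code (bot j)) (δE-other _ x≢)
    vanishes b (just (bot j′))     x↦ x≢ = Φ-vanishes-at b x _ x↦ (decode-code (bot j)) (δE-other _ x≢)
    vanishes b nothing             x↦ x≢ = Φ-vanishes-at b x _ x↦ (decode-code (bot j)) (δE-other _ x≢)

  col-bot-at : ∀ b j → Φ b (code (exit (port (wireAt b j)))) (code (bot j)) ≡ evalEntry (right (wireAt b j))
  col-bot-at b j =
    ≡.trans (Φ-at b x (code (bot j)) (decode-code (exit p)) (decode-code (bot j)))
            (≡.trans (at-exit b p (λ { ≡.refl → wire-zero-port j (gateAt gs j) })) (δE-same x (right (wireAt b j))))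
    where
    p = port (wireAt b j)
    x = code (exit p)
    at-exit : ∀ b p → (b ≡ zero → p ≢ one) →
              evalEntry (entryAt b x (code (bot j)) (just (exit p)) (just (bot j))) ≡
              evalEntry (δE x (code (exit (port (wireAt b j)))) (right (wireAt b j)))
    at-exit b          (gate c) _     = ≡.refl
    at-exit zero       one      p≢one = contradiction ≡.refl (p≢one ≡.refl)
    at-exit (suc zero) one      _     = ≡.refl

  row-mid₀ : ∀ y → y ≢ code mid → Φ zero (code mid) y ≃ 0ᴾ
  row-mid₀ y y≢mid = Φ-vanishes-at zero (code mid) y (decode-code mid) ≡.refl (δE-other _ y≢mid)

  mid-mid₀ : Φ zero (code mid) (code mid) ≡ 1ᴾ
  mid-mid₀ = ≡.trans (Φ-at zero (code mid) (code mid) (decode-code mid) ≡.refl) (δE-same (code mid) (fe 1#))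

  col-mid₀ : ∀ x → x ≢ code mid → Φ zero x (code mid) ≃ 0ᴾ
  col-mid₀ x x≢mid = vanishes (decode x) ≡.refl
    where
    vanishes : ∀ dx → decode x ≡ dx → Φ zero x (code mid) ≃ 0ᴾ
    vanishes (just (top j)) x↦ = Φ-vanishes-at zero x (code mid) x↦ (decode-code mid)
                                   (δE-other _ (code-≢ (mid≢entry (wire-zero-port j (gateAt gs j)))))
    vanishes (just mid)     x↦ = contradiction (decode-mid x x↦) x≢mid
    vanishes (just (bot j)) x↦ = Φ-vanishes-at zero x (code mid) x↦ (decode-code mid) constᴾ-zero
    vanishes nothing        x↦ = Φ-vanishes-at zero x (code mid) x↦ (decode-code mid) constᴾ-zero

  col-mid₁ : ∀ x → ¬ IsTop x → Φ (suc zero) x (code mid) ≃ 0ᴾ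
  col-mid₁ x ¬top-x = vanishes (decode x) ≡.refl
    where
    vanishes : ∀ dx → decode x ≡ dx → Φ (suc zero) x (code mid) ≃ 0ᴾ
    vanishes (just (top j)) x↦ = contradiction (j , x↦) ¬top-x
    vanishes (just mid)     x↦ = Φ-vanishes-at (suc zero) x (code mid) x↦ (decode-code mid) constᴾ-zero
    vanishes (just (bot j)) x↦ = Φ-vanishes-at (suc zero) x (code mid) x↦ (decode-code mid) constᴾ-zero
    vanishes nothing        x↦ = Φ-vanishes-at (suc zero) x (code mid) x↦ (decode-code mid) constᴾ-zero

  Φ-triangular : ∀ b → Triangular IsTop (Φ b)
  Φ-triangular b x y ¬top-x (j , y↦top) = vanishes b (decode x) ≡.refl
    where
    vanishes : ∀ b dx → decode x ≡ dx → Φ b x y ≃ 0ᴾ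
    vanishes b          (just (top j′)) x↦ = contradiction (j′ , x↦) ¬top-x
    vanishes zero       (just mid)      x↦ =
      Φ-vanishes-at zero x y x↦ y↦top (δE-other _ (≢-code {y} {t′ = mid} y↦top λ ()))
    vanishes (suc zero) (just mid)      x↦ = Φ-vanishes-at (suc zero) x y x↦ y↦top constᴾ-zero
    vanishes b          (just (bot j′)) x↦ = Φ-vanishes-at b x y x↦ y↦top constᴾ-zero
    vanishes b          nothing         x↦ = Φ-vanishes-at b x y x↦ y↦top constᴾ-zero

  open PalindromesAtMatrices F Φ

  PAL-at-triangular-top : ∀ m → Triangular IsTop (PAL-at m)
  PAL-at-triangular-top = PAL-at-triangular top? Φ-triangular

  PAL-at-mid : ∀ m → PAL-at m (code mid) (code mid) ≃ 1ᴾ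
  PAL-at-mid ℕ.zero    = trans (PAL-at-zero (code mid) (code mid)) (idM-diagonal (code mid))
  PAL-at-mid (ℕ.suc m) = begin
    PAL-at (ℕ.suc m) (code mid) (code mid)      ≈⟨ PAL-at-suc m (code mid) (code mid) ⟩
    sandwich zero (PAL-at m) (code mid) (code mid) +ᴾ sandwich (suc zero) (PAL-at m) (code mid) (code mid)
                                                ≈⟨ +-cong loop detour ⟩
    1ᴾ +ᴾ 0ᴾ                                    ≈⟨ +ᴾ-identityʳ 1ᴾ ⟩
    1ᴾ                                          ∎
    where
    loop : sandwich zero (PAL-at m) (code mid) (code mid) ≃ 1ᴾ
    loop = begin
      sandwich zero (PAL-at m) (code mid) (code mid)
        ≈⟨ *M-*M-single (Φ zero) (PAL-at m) (Φ zero) {code mid} {code mid} (code mid) (code mid) row-mid₀ col-mid₀ ⟩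
      Φ zero (code mid) (code mid) *ᴾ (PAL-at m (code mid) (code mid) *ᴾ Φ zero (code mid) (code mid))
        ≡⟨ ≡.cong₂ (λ a b → a *ᴾ (PAL-at m (code mid) (code mid) *ᴾ b)) mid-mid₀ mid-mid₀ ⟩
      1ᴾ *ᴾ (PAL-at m (code mid) (code mid) *ᴾ 1ᴾ)
        ≈⟨ trans (*-identityˡ _) (trans (*-identityʳ _) (PAL-at-mid m)) ⟩
      1ᴾ ∎
    detour : sandwich (suc zero) (PAL-at m) (code mid) (code mid) ≃ 0ᴾ
    detour = *M-*M-vanishes top? (PAL-at-triangular-top m) (Φ (suc zero)) (Φ (suc zero)) {code mid} {code mid}
               (λ i top-i → Φ-triangular (suc zero) (code mid) i ¬top-mid top-i) col-mid₁

  -- Gates only read gates of larger index, so gate j is computed after s ∸ j levels.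
  PAL-at-gate : ∀ m j → s ≤ m + toℕ j → PAL-at m (code (top j)) (code (bot j)) ≃ evalGates gs j
  PAL-at-gate ℕ.zero    j s≤j     = contradiction s≤j (<⇒≱ (toℕ<n j))
  PAL-at-gate (ℕ.suc m) j s≤1+m+j = begin
    PAL-at (ℕ.suc m) (code (top j)) (code (bot j))
      ≈⟨ PAL-at-suc m (code (top j)) (code (bot j)) ⟩
    sandwich zero (PAL-at m) (code (top j)) (code (bot j)) +ᴾ sandwich (suc zero) (PAL-at m) (code (top j)) (code (bot j))
      ≈⟨ +-cong (through zero) (through (suc zero)) ⟩
    along V (wireAt zero j) +ᴾ along V (wireAt (suc zero) j)
      ≈⟨ along-wires-correct V (evalGates gs) j (gateAt gs j) (gateAt-childrenAbove gs j) (PAL-at-mid m) earlier ⟩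
    evalGate (evalGates gs) (gateAt gs j)
      ≡⟨ ≡.sym (evalGates-gateAt gs j) ⟩
    evalGates gs j ∎
    where
    V : Port → NCPoly k
    V p = PAL-at m (code (entry p)) (code (exit p))
    through : ∀ b → sandwich b (PAL-at m) (code (top j)) (code (bot j)) ≃ along V (wireAt b j)
    through b = trans
      (*M-*M-single (Φ b) (PAL-at m) (Φ b) {code (top j)} {code (bot j)} (code (entry p)) (code (exit p))
                    (row-top b j) (col-bot b j))
      (reflexive (≡.cong₂ (λ l r → l *ᴾ (V p *ᴾ r)) (row-top-at b j) (col-bot-at b j)))
      where p = port (wireAt b j)
    earlier : ∀ c → j Fin.< c → V (gate c) ≃ evalGates gs c
    earlier c j<c = PAL-at-gate m c
      (≤-trans s≤1+m+j (≤-trans (≤-reflexive (≡.sym (+-suc m (toℕ j)))) (+-monoʳ-≤ m j<c)))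

  PAL-at-output : ∀ m → s ≤ m → PAL-at m zero (fromℕ Q) ≃ evalGates gs zero
  PAL-at-output m s≤m = ≡.subst (λ y → PAL-at m zero y ≃ evalGates gs zero) code-bot-zero
                          (PAL-at-gate m zero (≤-trans s≤m (≤-reflexive (≡.sym (+-identityʳ m)))))

module CoefficientLists where
  open import Data.Nat using (_+_; _*_; _^_)
  open import Data.Nat.Properties using (*-distribˡ-+; *-zeroʳ; +-identityʳ; +-commutativeSemigroup)
  open import Algebra.Properties.CommutativeSemigroup +-commutativeSemigroup using (interchange)

  infixl 6 _⊕_

  _⊕_ : List ℕ → List ℕ → List ℕ
  []       ⊕ bs       = bs
  (a ∷ as) ⊕ []       = a ∷ as
  (a ∷ as) ⊕ (b ∷ bs) = a + b ∷ as ⊕ bs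

  evalℕPoly-⊕ : ∀ as bs n → evalℕPoly (as ⊕ bs) n ≡ evalℕPoly as n + evalℕPoly bs n
  evalℕPoly-⊕ []       bs       n = ≡.refl
  evalℕPoly-⊕ (a ∷ as) []       n = ≡.sym (+-identityʳ _)
  evalℕPoly-⊕ (a ∷ as) (b ∷ bs) n = ≡.trans
    (≡.cong (a + b +_) (≡.trans (≡.cong (n *_) (evalℕPoly-⊕ as bs n)) (*-distribˡ-+ n _ _)))
    (interchange a b _ _)

  X^ : ℕ → List ℕ
  X^ ℕ.zero    = 1 ∷ []
  X^ (ℕ.suc e) = 0 ∷ X^ e

  evalℕPoly-X^ : ∀ e n → evalℕPoly (X^ e) n ≡ n ^ e
  evalℕPoly-X^ ℕ.zero    n = ≡.cong (1 +_) (*-zeroʳ n)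
  evalℕPoly-X^ (ℕ.suc e) n = ≡.cong (n *_) (evalℕPoly-X^ e n)

  evalℕPoly-X^+ : ∀ e n → evalℕPoly (X^ e ⊕ (e ∷ [])) n ≡ n ^ e + e
  evalℕPoly-X^+ e n = ≡.trans (evalℕPoly-⊕ (X^ e) (e ∷ []) n)
    (≡.cong₂ _+_ (evalℕPoly-X^ e n) (≡.trans (≡.cong (e +_) (*-zeroʳ n)) (+-identityʳ e)))

open CoefficientLists

module Hardness {c ℓ} (F : Field c ℓ) where
  open import Data.Nat using (_+_; _^_)
  open Field F using (sym; trans)
  open Over F
  open Polynomials F

  skewCircuit⇒PAL-entry : ∀ {k S} {p : NCPoly k} m Q → SkewCircuitOfSize S p → S + S ≤ Q → S ≤ m →
    Σ (Fin 2 → Fin (ℕ.suc Q) → Fin (ℕ.suc Q) → Entry k) λ φ →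
      p ≋ evalAtMatrices (poly PAL m) (λ y i j → evalEntry (φ y i j)) zero (fromℕ Q)
  skewCircuit⇒PAL-entry m Q (_ , s≤S , gs , gs≋p) S+S≤Q S≤m =
    φ , λ w → trans (sym (gs≋p w)) (sym (coeff-≈ (PAL-at-output m (≤-trans s≤S S≤m)) w))
    where open SkewCircuitToPalindromes F gs s≤S S+S≤Q

  VSK≤PAL : ∀ f → VSKnc f → f ≤abp PAL
  VSK≤PAL f (_ , e , circuits) = size , size ⊕ size , λ n →
    skewCircuit⇒PAL-entry {p = poly f n} (evalℕPoly size n) (evalℕPoly (size ⊕ size) n) (circuits n)
      (≤-reflexive (≡.sym (≡.trans (evalℕPoly-⊕ size size n) (≡.cong₂ _+_ (size≡ n) (size≡ n)))))
      (≤-reflexive (≡.sym (size≡ n)))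
    where
    size = X^ e ⊕ (e ∷ [])
    size≡ : ∀ n → evalℕPoly size n ≡ n ^ e + e
    size≡ = evalℕPoly-X^+ e

mainTheorem2 : ∀ {c ℓ : Level} (F : Field c ℓ) →
    Over.VSKnc F (Over.PAL F) ×
    (∀ (f : Over.Family F) → Over.VSKnc F f → Over._≤abp_ F f (Over.PAL F))
mainTheorem2 F = PalindromesInVSK.PAL∈VSK F , Hardness.VSK≤PAL F
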